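{- Let $p$ be a prime, $d\mid p-1$ with $1<d<p-1$, and $\mu_d$ the set of $d$-th roots of unity in $\mathbb F_p$. If $A,B\subseteq\mathbb F_p$ satisfy $A+B=\mu_d$ or $A+B=\mu_d\cup\{0\}$, then for every integer $1\le k<d$, \[\sum_{a\in A,\,b\in B}(a+b)^k=0 \quad\text{in } \mathbb F_p.\]
   Context: $A+B=\{a+b:a\in A,b\in B\}$. -}

module Defs where

open import Data.Nat using (ℕ; _+_; _^_; _%_; NonZero)
open import Data.Fin using (Fin; toℕ)
open import Data.Fin.Subset using (Subset; _∈_)
open import Data.Fin.Subset.Properties using (_∈?_)
open import Data.List using (List; []; _∷_; concatMap; filter; allFin)
open import Data.Nat.ListAction using (sum)
open import Data.Product using (∃₂; _×_)
open import Relation.Binary.PropositionalEquality using (_≡_)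

-- 𝔽_p is modelled as Fin p (residues 0,…,p-1); arithmetic is ℕ-arithmetic followed by reduction mod p.

_∈Sumset_,_ : ∀ {p} .{{_ : NonZero p}} → Fin p → Subset p → Subset p → Set
_∈Sumset_,_ {p} x A B = ∃₂ λ (a b : Fin p) → a ∈ A × b ∈ B × toℕ x ≡ (toℕ a + toℕ b) % p

_∈μ_ : ∀ {p} .{{_ : NonZero p}} → Fin p → ℕ → Set
_∈μ_ {p} x d = (toℕ x ^ d) % p ≡ 1 % p

elems : ∀ {p} → Subset p → List (Fin p)
elems {p} A = filter (_∈? A) (allFin p)

-- Σ_{a ∈ A, b ∈ B} (a + b)^k, computed in ℕ (its residue mod p is the 𝔽_p value)
sumPow : ∀ {p} → Subset p → Subset p → ℕ → ℕ
sumPow A B k = sum (concatMap (λ a → concatMap (λ b → (toℕ a + toℕ b) ^ k ∷ []) (elems B)) (elems A))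

module Submission where

-- Hanson–Petridis via Stepanov's method: when a + B ⊆ μ_d ∪ {0} for every a ∈ A, the polynomial
--   F(x) = ((x + Y)^(d+|B|-1))[b₁, …, b_|B|] − 1   (a divided difference in Y over the nodes B)
-- has degree d and leading coefficient binom(d+|B|-1, d) ≢ 0 mod p, yet vanishes at each a ∈ A to
-- order |B| (or |B| − 1 if a ∈ −B), because (a + b)^(d+j) = (a + b)^j on the nodes.  Hence at most d
-- pairs (a, b) have a + b ≠ 0; as A + B ⊇ μ_d and |μ_d| = d, the nonzero sums a + b enumerate μ_d
-- exactly once, so Σ (a + b)^k = Σ_{ζ ∈ μ_d} ζ^k.  This vanishes because multiplication by some
-- ζ ∈ μ_d with ζ^k ≠ 1 permutes μ_d.

open import Defs
open import Data.Nat.Base as ℕ using (ℕ; zero; suc; _∸_; _<_; _≤_; _%_; _!; NonZero; z≤n; s≤s; nonTrivial⇒n>1)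
import Data.Nat.Properties as ℕₚ
open import Data.Nat.Properties using (_!*_!≢0)
open import Data.Nat.Divisibility using (_∣_; divides; _∣?_; ∣⇒≤; m∣m*n; ∣m⇒∣m*n; n∣m⇒m%n≡0)
open import Data.Nat.DivMod using (_/_; m/n*n≡m; m%n<n; m≡m%n+[m/n]*n)
open import Data.Nat.Primality using (Prime; euclidsLemma; prime⇒nonTrivial; prime⇒nonZero)
open import Data.Nat.Combinatorics
  using (_C_; nCk+nC[k+1]≡[n+1]C[k+1]; k>n⇒nCk≡0; nCn≡1; nCk≡n!/k![n-k]!; k![n∸k]!∣n!)
open import Data.Integer.Base using (ℤ; +_; _+_; _*_; _-_; -_; 0ℤ; 1ℤ; _^_; ∣_∣)
open import Data.Integer.Properties
  using ( pos-+; pos-*; *-zeroʳ; *-zeroˡ; *-identityˡ; *-identityʳ; +-identityˡ; +-identityʳ; +-inverseʳ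
        ; *-assoc; *-distribˡ-+; ^-distribˡ-+-*; ^-*-assoc; ^-zeroˡ; abs-*; m-n≡m⊖n; ⊖-≥)
open import Data.Integer.Divisibility.Signed as ℤᵈ
  using (∣ᵤ⇒∣; ∣⇒∣ᵤ) renaming (_∣_ to _∣ℤ_; divides to dividesℤ)
open import Data.Integer.Tactic.RingSolver using (solve-∀)
open import Data.Fin.Base using (Fin; toℕ; fromℕ<)
open import Data.Fin.Properties using (toℕ-injective; toℕ<n; toℕ-fromℕ<) renaming (_≟_ to _≟ᶠ_)
open import Data.Fin.Subset using (Subset) renaming (_∈_ to _∈ₛ_)
open import Data.Fin.Subset.Properties using () renaming (_∈?_ to _∈ₛ?_)
open import Data.List.Base
  using (List; []; _∷_; [_]; map; replicate; _++_; length; take; filter; allFin; concatMap; cartesianProductWith)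
open import Data.List.Properties
  using ( length-take; length-map; length-tabulate; length-++; length-replicate; length-filter; filter-++
        ; filter-notAll; map-∘; map-++; concatMap-map; concatMap-pure)
open import Data.List.Membership.Propositional using (_∈_; find)
open import Data.List.Membership.Propositional.Properties
  using (∈-filter⁺; ∈-filter⁻; ∈-allFin; ∈-∃++; ∈-map⁺; ∈-map⁻; ∈-cartesianProductWith⁺)
open import Data.List.Relation.Unary.Any as Any using (Any; here; there)
import Data.List.Relation.Unary.Any.Properties as Anyₚ
open import Data.List.Relation.Binary.Subset.Propositional using (_⊆_)
open import Data.List.Relation.Binary.Permutation.Propositional using (_↭_; ↭-refl; ↭-trans; ↭-prep)
open import Data.List.Relation.Binary.Permutation.Propositional.Properties
  using (∈-resp-↭; ↭-length) renaming (shift to ↭-shift; map⁺ to ↭-map⁺)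
open import Data.Nat.ListAction using (sum)
open import Data.Nat.ListAction.Properties using (sum-↭; sum-++)
open import Data.List.Relation.Unary.All as All using (All; []; _∷_)
import Data.List.Relation.Unary.All.Properties as Allₚ
open import Data.List.Relation.Unary.All.Properties.Core using (¬All⇒Any¬)
open import Data.List.Relation.Unary.AllPairs as AllPairs using (AllPairs; []; _∷_)
import Data.List.Relation.Unary.AllPairs.Properties as AllPairsₚ
open import Data.List.Relation.Unary.Unique.Propositional using (Unique)
import Data.List.Relation.Unary.Unique.Propositional.Properties as Uniqueₚ
open import Data.Sum.Base using (_⊎_; inj₁; inj₂; [_,_]′)
open import Data.Product.Base using (_×_; _,_; proj₁; proj₂; ∃)
open import Data.Empty using (⊥; ⊥-elim)
open import Function.Base using (_∘_; id)
open import Level using (0ℓ)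
open import Function.Bundles using (_⇔_; Equivalence)
open import Relation.Nullary using (¬_; Dec; yes; no; does)
open import Data.Bool.Base using (if_then_else_)
import Relation.Nullary.Decidable as Dec
open import Relation.Nullary.Decidable using (¬?)
open import Relation.Unary using (Decidable)
open import Relation.Binary.Bundles using (Setoid)
open import Relation.Binary.Structures using (IsEquivalence)
import Relation.Binary.Reasoning.Setoid as SetoidReasoning
open import Relation.Binary.PropositionalEquality hiding ([_])
open import Relation.Binary.Definitions using (tri<; tri≈; tri>)

pos-^ : ∀ m n → + (m ℕ.^ n) ≡ (+ m) ^ n
pos-^ m zero    = refl
pos-^ m (suc n) = trans (pos-* m (m ℕ.^ n)) (cong (+ m *_) (pos-^ m n))

^-distribʳ-* : ∀ x y n → (x * y) ^ n ≡ x ^ n * y ^ n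
^-distribʳ-* x y zero    = refl
^-distribʳ-* x y (suc n) = trans (cong (x * y *_) (^-distribʳ-* x y n)) (lemma x y (x ^ n) (y ^ n))
  where lemma : ∀ x y u v → x * y * (u * v) ≡ x * u * (y * v)
        lemma = solve-∀

^-comm : ∀ x m n → (x ^ m) ^ n ≡ (x ^ n) ^ m
^-comm x m n = trans (^-*-assoc x m n) (trans (cong (x ^_) (ℕₚ.*-comm m n)) (sym (^-*-assoc x n m)))

-- Polynomials over ℤ

Poly : Set
Poly = List ℤ

eval : Poly → ℤ → ℤ
eval []       x = 0ℤ
eval (c ∷ cs) x = c + x * eval cs x

coeff : ℕ → Poly → ℤ
coeff i       []       = 0ℤ
coeff zero    (c ∷ cs) = c
coeff (suc i) (c ∷ cs) = coeff i cs

infixl 6 _+ₚ_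
_+ₚ_ : Poly → Poly → Poly
[]       +ₚ ds       = ds
(c ∷ cs) +ₚ []       = c ∷ cs
(c ∷ cs) +ₚ (d ∷ ds) = c + d ∷ cs +ₚ ds

infixr 7 _·ₚ_
_·ₚ_ : ℤ → Poly → Poly
c ·ₚ q = map (c *_) q

shift : ℕ → Poly → Poly
shift n q = replicate n 0ℤ ++ q

monomial : ℕ → ℤ → Poly
monomial n c = shift n [ c ]

eval-+ₚ : ∀ q r x → eval (q +ₚ r) x ≡ eval q x + eval r x
eval-+ₚ []       r        x = sym (+-identityˡ _)
eval-+ₚ (c ∷ cs) []       x = sym (+-identityʳ _)
eval-+ₚ (c ∷ cs) (d ∷ ds) x =
  trans (cong (λ t → c + d + x * t) (eval-+ₚ cs ds x)) (lemma c d x (eval cs x) (eval ds x))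
  where lemma : ∀ c d x u v → c + d + x * (u + v) ≡ c + x * u + (d + x * v)
        lemma = solve-∀

eval-·ₚ : ∀ c q x → eval (c ·ₚ q) x ≡ c * eval q x
eval-·ₚ c []       x = sym (*-zeroʳ c)
eval-·ₚ c (d ∷ ds) x = trans (cong (λ t → c * d + x * t) (eval-·ₚ c ds x)) (lemma c d x (eval ds x))
  where lemma : ∀ c d x u → c * d + x * (c * u) ≡ c * (d + x * u)
        lemma = solve-∀

eval-shift : ∀ n q y → eval (shift n q) y ≡ y ^ n * eval q y
eval-shift zero    q y = sym (*-identityˡ _)
eval-shift (suc n) q y = trans (cong (λ t → 0ℤ + y * t) (eval-shift n q y)) (lemma y (y ^ n) (eval q y))
  where lemma : ∀ y a t → 0ℤ + y * (a * t) ≡ y * a * t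
        lemma = solve-∀

eval-monomial : ∀ n c y → eval (monomial n c) y ≡ c * y ^ n
eval-monomial n c y = trans (eval-shift n [ c ] y) (lemma c y (y ^ n))
  where lemma : ∀ c y t → t * (c + y * 0ℤ) ≡ c * t
        lemma = solve-∀

coeff-+ₚ : ∀ i q r → coeff i (q +ₚ r) ≡ coeff i q + coeff i r
coeff-+ₚ i       []       r        = sym (+-identityˡ _)
coeff-+ₚ i       (c ∷ cs) []       = sym (+-identityʳ _)
coeff-+ₚ zero    (c ∷ cs) (d ∷ ds) = refl
coeff-+ₚ (suc i) (c ∷ cs) (d ∷ ds) = coeff-+ₚ i cs ds

coeff-·ₚ : ∀ i c q → coeff i (c ·ₚ q) ≡ c * coeff i q
coeff-·ₚ i       c []       = sym (*-zeroʳ c)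
coeff-·ₚ zero    c (d ∷ ds) = refl
coeff-·ₚ (suc i) c (d ∷ ds) = coeff-·ₚ i c ds

coeff-shift-< : ∀ n q {i} → i < n → coeff i (shift n q) ≡ 0ℤ
coeff-shift-< (suc n) q {zero}  _         = refl
coeff-shift-< (suc n) q {suc i} (s≤s i<n) = coeff-shift-< n q i<n

coeff-shift-+ : ∀ n q i → coeff (n ℕ.+ i) (shift n q) ≡ coeff i q
coeff-shift-+ zero    q i = refl
coeff-shift-+ (suc n) q i = coeff-shift-+ n q i

coeff-const : ∀ c {i} → 0 < i → coeff i [ c ] ≡ 0ℤ
coeff-const c {suc i} _ = refl

coeff-monomial-≡ : ∀ n c → coeff n (monomial n c) ≡ c
coeff-monomial-≡ n c = trans (cong (λ i → coeff i (monomial n c)) (sym (ℕₚ.+-identityʳ n)))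
                             (coeff-shift-+ n [ c ] 0)

coeff-monomial-≢ : ∀ n c {i} → i ≢ n → coeff i (monomial n c) ≡ 0ℤ
coeff-monomial-≢ n c {i} i≢n with ℕₚ.<-cmp i n
... | tri< i<n _ _ = coeff-shift-< n [ c ] i<n
... | tri≈ _ i≡n _ = ⊥-elim (i≢n i≡n)
... | tri> _ _ i>n = trans (cong (λ j → coeff j (monomial n c)) (sym (ℕₚ.m+[n∸m]≡n (ℕₚ.<⇒≤ i>n))))
                       (trans (coeff-shift-+ n [ c ] (i ∸ n)) (coeff-const c (ℕₚ.m<n⇒0<n∸m i>n)))

-- synDiv q a is the quotient of q by X − a
synDiv : Poly → ℤ → Poly
synDiv []           a = []
synDiv (c ∷ [])     a = []
synDiv (c ∷ d ∷ ds) a = eval (d ∷ ds) a ∷ synDiv (d ∷ ds) a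

eval-synDiv : ∀ q x a → eval q x ≡ (x - a) * eval (synDiv q a) x + eval q a
eval-synDiv []           x a = lemma x a
  where lemma : ∀ x a → 0ℤ ≡ (x - a) * 0ℤ + 0ℤ
        lemma = solve-∀
eval-synDiv (c ∷ [])     x a = lemma c x a
  where lemma : ∀ c x a → c + x * 0ℤ ≡ (x - a) * 0ℤ + (c + a * 0ℤ)
        lemma = solve-∀
eval-synDiv (c ∷ d ∷ ds) x a =
  trans (cong (λ t → c + x * t) (eval-synDiv (d ∷ ds) x a))
        (lemma c x a (eval (synDiv (d ∷ ds) a) x) (eval (d ∷ ds) a))
  where lemma : ∀ c x a Q E → c + x * ((x - a) * Q + E) ≡ (x - a) * (E + x * Q) + (c + a * E)
        lemma = solve-∀

synDiv-+ₚ : ∀ q r a → synDiv (q +ₚ r) a ≡ synDiv q a +ₚ synDiv r a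
synDiv-+ₚ []           r            a = refl
synDiv-+ₚ (c ∷ cs)     []           a = sym (+ₚ-identityʳ (synDiv (c ∷ cs) a))
  where +ₚ-identityʳ : ∀ q → q +ₚ [] ≡ q
        +ₚ-identityʳ []      = refl
        +ₚ-identityʳ (_ ∷ _) = refl
synDiv-+ₚ (c ∷ [])     (d ∷ [])     a = refl
synDiv-+ₚ (c ∷ [])     (d ∷ e ∷ es) a = refl
synDiv-+ₚ (c ∷ e ∷ es) (d ∷ [])     a = refl
synDiv-+ₚ (c ∷ e ∷ es) (d ∷ f ∷ fs) a =
  cong₂ _∷_ (eval-+ₚ (e ∷ es) (f ∷ fs) a) (synDiv-+ₚ (e ∷ es) (f ∷ fs) a)

synDiv-·ₚ : ∀ c q a → synDiv (c ·ₚ q) a ≡ c ·ₚ synDiv q a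
synDiv-·ₚ c []           a = refl
synDiv-·ₚ c (d ∷ [])     a = refl
synDiv-·ₚ c (d ∷ e ∷ es) a = cong₂ _∷_ (eval-·ₚ c (e ∷ es) a) (synDiv-·ₚ c (e ∷ es) a)

eval-synDiv-comm : ∀ q a b → eval (synDiv q a) b ≡ eval (synDiv q b) a
eval-synDiv-comm []           a b = refl
eval-synDiv-comm (c ∷ [])     a b = refl
eval-synDiv-comm (c ∷ r@(d ∷ ds)) a b = begin
  eval r a + b * eval (synDiv r a) b                ≡⟨ cong (λ t → eval r a + b * t) (eval-synDiv-comm r a b) ⟩
  eval r a + b * X                                  ≡⟨ lemma (eval r a) a b X ⟩
  (b - a) * X + eval r a + a * X                    ≡⟨ cong (λ t → (b - a) * t + eval r a + a * X)
                                                                (eval-synDiv-comm r a b) ⟨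
  (b - a) * eval (synDiv r a) b + eval r a + a * X  ≡⟨ cong (_+ a * X) (eval-synDiv r b a) ⟨
  eval r b + a * X                                  ∎
  where
  open ≡-Reasoning
  X = eval (synDiv r b) a
  lemma : ∀ E a b X → E + b * X ≡ (b - a) * X + E + a * X
  lemma = solve-∀

synDiv-comm : ∀ q a b → synDiv (synDiv q a) b ≡ synDiv (synDiv q b) a
synDiv-comm []               a b = refl
synDiv-comm (c ∷ [])         a b = refl
synDiv-comm (c ∷ d ∷ [])     a b = refl
synDiv-comm (c ∷ d ∷ e ∷ es) a b =
  cong₂ _∷_ (eval-synDiv-comm (d ∷ e ∷ es) a b) (synDiv-comm (d ∷ e ∷ es) a b)

synDivⁿ : ℕ → Poly → ℤ → Poly
synDivⁿ zero    q a = q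
synDivⁿ (suc i) q a = synDivⁿ i (synDiv q a) a

synDivⁿ-suc : ∀ i q a → synDivⁿ (suc i) q a ≡ synDiv (synDivⁿ i q a) a
synDivⁿ-suc zero    q a = refl
synDivⁿ-suc (suc i) q a = synDivⁿ-suc i (synDiv q a) a

synDivⁿ-synDiv-comm : ∀ i q a b → synDivⁿ i (synDiv q b) a ≡ synDiv (synDivⁿ i q a) b
synDivⁿ-synDiv-comm zero    q a b = refl
synDivⁿ-synDiv-comm (suc i) q a b =
  trans (cong (λ t → synDivⁿ i t a) (synDiv-comm q b a)) (synDivⁿ-synDiv-comm i (synDiv q a) a b)

-- hasse q a i is the coefficient of T^i in q(a + T)
hasse : Poly → ℤ → ℕ → ℤ
hasse []       a i       = 0ℤ
hasse (c ∷ cs) a zero    = c + a * hasse cs a zero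
hasse (c ∷ cs) a (suc i) = hasse cs a i + a * hasse cs a (suc i)

hasse-zero : ∀ q a → hasse q a 0 ≡ eval q a
hasse-zero []       a = refl
hasse-zero (c ∷ cs) a = cong (λ t → c + a * t) (hasse-zero cs a)

hasse-synDiv : ∀ q a i → hasse (synDiv q a) a i ≡ hasse q a (suc i)
hasse-synDiv []           a i       = refl
hasse-synDiv (c ∷ [])     a i       = lemma a
  where lemma : ∀ a → 0ℤ ≡ 0ℤ + a * 0ℤ
        lemma = solve-∀
hasse-synDiv (c ∷ d ∷ ds) a zero    =
  cong₂ (λ u v → u + a * v) (sym (hasse-zero (d ∷ ds) a)) (hasse-synDiv (d ∷ ds) a 0)
hasse-synDiv (c ∷ d ∷ ds) a (suc i) =
  cong₂ (λ u v → u + a * v) (hasse-synDiv (d ∷ ds) a i) (hasse-synDiv (d ∷ ds) a (suc i))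

eval-synDivⁿ : ∀ i q a → eval (synDivⁿ i q a) a ≡ hasse q a i
eval-synDivⁿ zero    q a = sym (hasse-zero q a)
eval-synDivⁿ (suc i) q a = trans (eval-synDivⁿ i (synDiv q a) a) (hasse-synDiv q a i)

hasse-+ₚ : ∀ q r a i → hasse (q +ₚ r) a i ≡ hasse q a i + hasse r a i
hasse-+ₚ []       r        a i       = sym (+-identityˡ _)
hasse-+ₚ (c ∷ cs) []       a i       = sym (+-identityʳ _)
hasse-+ₚ (c ∷ cs) (d ∷ ds) a zero    =
  trans (cong (λ t → c + d + a * t) (hasse-+ₚ cs ds a 0)) (lemma c d a (hasse cs a 0) (hasse ds a 0))
  where lemma : ∀ c d a u v → c + d + a * (u + v) ≡ c + a * u + (d + a * v)
        lemma = solve-∀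
hasse-+ₚ (c ∷ cs) (d ∷ ds) a (suc i) =
  trans (cong₂ (λ s t → s + a * t) (hasse-+ₚ cs ds a i) (hasse-+ₚ cs ds a (suc i)))
        (lemma a (hasse cs a i) (hasse ds a i) (hasse cs a (suc i)) (hasse ds a (suc i)))
  where lemma : ∀ a u v u′ v′ → u + v + a * (u′ + v′) ≡ u + a * u′ + (v + a * v′)
        lemma = solve-∀

hasse-at-0 : ∀ q i → hasse q 0ℤ i ≡ coeff i q
hasse-at-0 []       i       = refl
hasse-at-0 (c ∷ cs) zero    = trans (cong (λ t → c + t) (*-zeroˡ (hasse cs 0ℤ 0))) (+-identityʳ c)
hasse-at-0 (c ∷ cs) (suc i) =
  trans (cong (λ t → hasse cs 0ℤ i + t) (*-zeroˡ (hasse cs 0ℤ (suc i)))) (trans (+-identityʳ _) (hasse-at-0 cs i))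

geometric : ℕ → ℕ → Poly
geometric d zero    = []
geometric d (suc n) = [ 1ℤ ] +ₚ shift d (geometric d n)

eval-geometric : ∀ d n y → (y ^ d - 1ℤ) * eval (geometric d n) y ≡ y ^ (n ℕ.* d) - 1ℤ
eval-geometric d zero    y = lemma (y ^ d)
  where lemma : ∀ t → (t - 1ℤ) * 0ℤ ≡ 1ℤ - 1ℤ
        lemma = solve-∀
eval-geometric d (suc n) y = begin
  (y ^ d - 1ℤ) * eval ([ 1ℤ ] +ₚ shift d (geometric d n)) y
    ≡⟨ cong ((y ^ d - 1ℤ) *_) (eval-+ₚ [ 1ℤ ] (shift d (geometric d n)) y) ⟩
  (y ^ d - 1ℤ) * ((1ℤ + y * 0ℤ) + eval (shift d (geometric d n)) y)
    ≡⟨ cong (λ t → (y ^ d - 1ℤ) * ((1ℤ + y * 0ℤ) + t)) (eval-shift d (geometric d n) y) ⟩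
  (y ^ d - 1ℤ) * ((1ℤ + y * 0ℤ) + y ^ d * Q)   ≡⟨ lemma y (y ^ d) Q ⟩
  y ^ d - 1ℤ + y ^ d * ((y ^ d - 1ℤ) * Q)      ≡⟨ cong (λ t → y ^ d - 1ℤ + y ^ d * t) (eval-geometric d n y) ⟩
  y ^ d - 1ℤ + y ^ d * (y ^ (n ℕ.* d) - 1ℤ)   ≡⟨ lemma′ (y ^ d) (y ^ (n ℕ.* d)) ⟩
  y ^ d * y ^ (n ℕ.* d) - 1ℤ                  ≡⟨ cong (_- 1ℤ) (^-distribˡ-+-* y d (n ℕ.* d)) ⟨
  y ^ (suc n ℕ.* d) - 1ℤ                      ∎
  where
  open ≡-Reasoning
  Q = eval (geometric d n) y
  lemma : ∀ y a Q → (a - 1ℤ) * ((1ℤ + y * 0ℤ) + a * Q) ≡ a - 1ℤ + a * ((a - 1ℤ) * Q)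
  lemma = solve-∀
  lemma′ : ∀ a b → a - 1ℤ + a * (b - 1ℤ) ≡ a * b - 1ℤ
  lemma′ = solve-∀

coeff-geometric-top : ∀ d n → 0 < d → coeff (n ℕ.* d) (geometric d (suc n)) ≡ 1ℤ
coeff-geometric-top d zero    0<d =
  trans (coeff-+ₚ 0 [ 1ℤ ] (shift d [])) (trans (cong (λ t → 1ℤ + t) (coeff-shift-< d [] 0<d)) refl)
coeff-geometric-top d (suc n) 0<d = begin
  coeff (d ℕ.+ n ℕ.* d) ([ 1ℤ ] +ₚ shift d (geometric d (suc n)))
    ≡⟨ coeff-+ₚ (d ℕ.+ n ℕ.* d) [ 1ℤ ] (shift d (geometric d (suc n))) ⟩
  coeff (d ℕ.+ n ℕ.* d) [ 1ℤ ] + coeff (d ℕ.+ n ℕ.* d) (shift d (geometric d (suc n)))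
    ≡⟨ cong₂ _+_ (coeff-const 1ℤ (ℕₚ.<-≤-trans 0<d (ℕₚ.m≤m+n d (n ℕ.* d))))
                 (coeff-shift-+ d (geometric d (suc n)) (n ℕ.* d)) ⟩
  0ℤ + coeff (n ℕ.* d) (geometric d (suc n))
    ≡⟨ cong (λ t → 0ℤ + t) (coeff-geometric-top d n 0<d) ⟩
  1ℤ ∎
  where open ≡-Reasoning

coeff-geometric-high : ∀ d n {j} → n ℕ.* d < j → coeff j (geometric d (suc n)) ≡ 0ℤ
coeff-geometric-below : ∀ d n {i} → n ℕ.* d < d ℕ.+ i → coeff i (geometric d n) ≡ 0ℤ

coeff-geometric-high d n {j} nd<j =
  trans (coeff-+ₚ j [ 1ℤ ] (shift d (geometric d n)))
        (trans (cong₂ _+_ (coeff-const 1ℤ (ℕₚ.≤-<-trans z≤n nd<j)) shifted) (+-identityˡ 0ℤ))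
  where
  shifted : coeff j (shift d (geometric d n)) ≡ 0ℤ
  shifted with j ℕₚ.<? d
  ... | yes j<d = coeff-shift-< d (geometric d n) j<d
  ... | no  j≮d = begin
    coeff j (shift d (geometric d n))             ≡⟨ cong (λ i → coeff i (shift d (geometric d n))) j≡d+i ⟩
    coeff (d ℕ.+ (j ∸ d)) (shift d (geometric d n)) ≡⟨ coeff-shift-+ d (geometric d n) (j ∸ d) ⟩
    coeff (j ∸ d) (geometric d n)                 ≡⟨ coeff-geometric-below d n (subst (n ℕ.* d <_) j≡d+i nd<j) ⟩
    0ℤ                                            ∎
    where
    open ≡-Reasoning
    j≡d+i : j ≡ d ℕ.+ (j ∸ d)
    j≡d+i = sym (ℕₚ.m+[n∸m]≡n (ℕₚ.≮⇒≥ j≮d))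

coeff-geometric-below d zero    _  = refl
coeff-geometric-below d (suc n) lt = coeff-geometric-high d n (ℕₚ.+-cancelˡ-< d _ _ lt)

module _ {A : Set} where

  private
    record Removal (x : A) (ys : List A) : Set where
      field
        rest        : List A
        ↭-∷rest     : ys ↭ x ∷ rest
        keeps-others : ∀ {y} → y ∈ ys → y ≢ x → y ∈ rest

    remove : ∀ {x ys} → x ∈ ys → Removal x ys
    remove {x} {ys} x∈ys with ∈-∃++ x∈ys
    ... | ws , zs , refl = record
      { rest         = ws ++ zs
      ; ↭-∷rest      = ↭-shift x ws zs
      ; keeps-others = λ y∈ys y≢x → drop-x (∈-resp-↭ (↭-shift x ws zs) y∈ys) y≢x
      }
      where
      drop-x : ∀ {y} → y ∈ x ∷ ws ++ zs → y ≢ x → y ∈ ws ++ zs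
      drop-x (here y≡x) y≢x = ⊥-elim (y≢x y≡x)
      drop-x (there y∈) _   = y∈

    ∉⇒≢ : ∀ {x : A} {xs} → All (x ≢_) xs → ∀ {y} → y ∈ xs → y ≢ x
    ∉⇒≢ (x≢y ∷ _)    (here refl) = x≢y ∘ sym
    ∉⇒≢ (_ ∷ x≢ys) (there y∈)  = ∉⇒≢ x≢ys y∈

  Unique-⊆⇒length≤ : ∀ xs ys → Unique xs → xs ⊆ ys → length xs ≤ length ys
  Unique-⊆⇒length≤ []       ys _             _    = z≤n
  Unique-⊆⇒length≤ (x ∷ xs) ys (x∉xs ∷ uniq) x∷xs⊆ys =
    subst (suc (length xs) ≤_) (sym (↭-length (Removal.↭-∷rest r)))
      (s≤s (Unique-⊆⇒length≤ xs (Removal.rest r) uniq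
             (λ y∈xs → Removal.keeps-others r (x∷xs⊆ys (there y∈xs)) (∉⇒≢ x∉xs y∈xs))))
    where r = remove (x∷xs⊆ys (here refl))

  ⊇-length≤⇒↭ : ∀ xs ys → Unique ys → ys ⊆ xs → length xs ≤ length ys → xs ↭ ys
  ⊇-length≤⇒↭ []       []       _            _     _   = ↭-refl
  ⊇-length≤⇒↭ (x ∷ xs) []       _            _     ()
  ⊇-length≤⇒↭ xs       (y ∷ ys) (y∉ys ∷ uniq) y∷ys⊆xs len =
    ↭-trans (Removal.↭-∷rest r)
      (↭-prep y (⊇-length≤⇒↭ (Removal.rest r) ys uniq
                  (λ z∈ys → Removal.keeps-others r (y∷ys⊆xs (there z∈ys)) (∉⇒≢ y∉ys z∈ys))
                  (ℕₚ.≤-pred (subst (_≤ suc (length ys)) (↭-length (Removal.↭-∷rest r)) len))))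
    where r = remove (y∷ys⊆xs (here refl))

  sum-map-filter : ∀ {P : A → Set} (P? : Decidable P) (f : A → ℕ) → (∀ x → ¬ P x → f x ≡ 0) →
                   ∀ xs → sum (map f xs) ≡ sum (map f (filter P? xs))
  sum-map-filter P? f f≡0 []       = refl
  sum-map-filter P? f f≡0 (x ∷ xs) with P? x
  ... | yes _  = cong (f x ℕ.+_) (sum-map-filter P? f f≡0 xs)
  ... | no ¬Px = trans (cong (ℕ._+ sum (map f xs)) (f≡0 x ¬Px)) (sum-map-filter P? f f≡0 xs)

  length-filter-split : ∀ {P : A → Set} (P? : Decidable P) xs →
                        length xs ≡ length (filter P? xs) ℕ.+ length (filter (¬? ∘ P?) xs)
  length-filter-split P? []       = refl
  length-filter-split P? (x ∷ xs) with P? x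
  ... | yes _ = cong suc (length-filter-split P? xs)
  ... | no  _ = trans (cong suc (length-filter-split P? xs)) (sym (ℕₚ.+-suc _ _))

-- Divided differences and Hasse derivatives of powers

-- divDiff b (b₁ ∷ … ∷ bₑ ∷ []) q is the divided difference q[b, b₁, …, bₑ]
divDiff : ℤ → List ℤ → Poly → ℤ
divDiff b []        q = eval q b
divDiff b (b′ ∷ bs) q = divDiff b′ bs (synDiv q b)

record IsLinear (ℓ : Poly → ℤ) : Set where
  field
    linear-+ₚ : ∀ q r → ℓ (q +ₚ r) ≡ ℓ q + ℓ r
    linear-·ₚ : ∀ c q → ℓ (c ·ₚ q) ≡ c * ℓ q

open IsLinear

linear-[] : ∀ {ℓ} → IsLinear ℓ → ℓ [] ≡ 0ℤ
linear-[] {ℓ} L = trans (linear-·ₚ L 0ℤ []) (*-zeroˡ (ℓ []))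

linear-∘X : ∀ {ℓ} → IsLinear ℓ → IsLinear (ℓ ∘ (0ℤ ∷_))
linear-∘X {ℓ} L = record
  { linear-+ₚ = λ q r → linear-+ₚ L (0ℤ ∷ q) (0ℤ ∷ r)
  ; linear-·ₚ = λ c q → trans (cong (λ t → ℓ (t ∷ c ·ₚ q)) (sym (*-zeroʳ c))) (linear-·ₚ L c (0ℤ ∷ q))
  }

divDiff-linear : ∀ b bs → IsLinear (divDiff b bs)
divDiff-linear b []        = record { linear-+ₚ = λ q r → eval-+ₚ q r b ; linear-·ₚ = λ c q → eval-·ₚ c q b }
divDiff-linear b (b′ ∷ bs) = record
  { linear-+ₚ = λ q r → trans (cong (divDiff b′ bs) (synDiv-+ₚ q r b))
                              (linear-+ₚ (divDiff-linear b′ bs) (synDiv q b) (synDiv r b))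
  ; linear-·ₚ = λ c q → trans (cong (divDiff b′ bs) (synDiv-·ₚ c q b))
                              (linear-·ₚ (divDiff-linear b′ bs) c (synDiv q b))
  }

mulLinear : ℤ → Poly → Poly
mulLinear a q = a ·ₚ q +ₚ (0ℤ ∷ q)

eval-mulLinear : ∀ a q y → eval (mulLinear a q) y ≡ (a + y) * eval q y
eval-mulLinear a q y =
  trans (eval-+ₚ (a ·ₚ q) (0ℤ ∷ q) y)
        (trans (cong (λ t → t + (0ℤ + y * eval q y)) (eval-·ₚ a q y)) (lemma a y (eval q y)))
  where lemma : ∀ a y e → a * e + (0ℤ + y * e) ≡ (a + y) * e
        lemma = solve-∀

coeff-mulLinear : ∀ i a q → coeff i (mulLinear a q) ≡ a * coeff i q + coeff i (0ℤ ∷ q)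
coeff-mulLinear i a q = trans (coeff-+ₚ i (a ·ₚ q) (0ℤ ∷ q)) (cong (_+ coeff i (0ℤ ∷ q)) (coeff-·ₚ i a q))

-- the i-th Hasse derivative in X of (X + Y)^D at X = a, a polynomial in Y
hassePower : ℤ → ℕ → ℕ → Poly
hassePower a zero    zero    = [ 1ℤ ]
hassePower a zero    (suc i) = []
hassePower a (suc D) zero    = mulLinear a (hassePower a D zero)
hassePower a (suc D) (suc i) = mulLinear a (hassePower a D (suc i)) +ₚ hassePower a D i

eval-hassePower : ∀ a D i y → eval (hassePower a D i) y ≡ + (D C i) * (a + y) ^ (D ∸ i)
eval-hassePower a zero    zero    y = lemma y
  where lemma : ∀ y → 1ℤ + y * 0ℤ ≡ 1ℤ * 1ℤ
        lemma = solve-∀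
eval-hassePower a zero    (suc i) y = sym (*-zeroˡ ((a + y) ^ 0))
eval-hassePower a (suc D) zero    y =
  trans (eval-mulLinear a (hassePower a D 0) y)
        (trans (cong ((a + y) *_) (eval-hassePower a D 0 y)) (lemma (a + y) ((a + y) ^ D)))
  where lemma : ∀ s t → s * (1ℤ * t) ≡ 1ℤ * (s * t)
        lemma = solve-∀
eval-hassePower a (suc D) (suc i) y = begin
  eval (mulLinear a (hassePower a D (suc i)) +ₚ hassePower a D i) y
    ≡⟨ eval-+ₚ (mulLinear a (hassePower a D (suc i))) (hassePower a D i) y ⟩
  eval (mulLinear a (hassePower a D (suc i))) y + eval (hassePower a D i) y
    ≡⟨ cong₂ _+_ (trans (eval-mulLinear a (hassePower a D (suc i)) y)
                        (cong (s *_) (eval-hassePower a D (suc i) y)))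
                 (eval-hassePower a D i y) ⟩
  s * (+ (D C suc i) * s ^ (D ∸ suc i)) + + (D C i) * s ^ (D ∸ i)
    ≡⟨ pascal-step ⟩
  + (D C i ℕ.+ D C suc i) * s ^ (D ∸ i)
    ≡⟨ cong (λ n → + n * s ^ (D ∸ i)) (nCk+nC[k+1]≡[n+1]C[k+1] D i) ⟩
  + (suc D C suc i) * s ^ (D ∸ i) ∎
  where
  open ≡-Reasoning
  s = a + y
  u = D C i
  v = D C suc i
  t = s ^ (D ∸ suc i)
  pascal-step : s * (+ v * t) + + u * s ^ (D ∸ i) ≡ + (u ℕ.+ v) * s ^ (D ∸ i)
  pascal-step with i ℕₚ.<? D
  ... | yes i<D = begin
    s * (+ v * t) + + u * s ^ (D ∸ i) ≡⟨ cong (λ n → s * (+ v * t) + + u * s ^ n) D∸i≡1+m ⟩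
    s * (+ v * t) + + u * (s * t)     ≡⟨ lemma s t (+ u) (+ v) ⟩
    (+ u + + v) * (s * t)             ≡⟨ cong₂ (λ x n → x * s ^ n) (pos-+ u v) D∸i≡1+m ⟨
    + (u ℕ.+ v) * s ^ (D ∸ i)         ∎
    where
    D∸i≡1+m : D ∸ i ≡ suc (D ∸ suc i)
    D∸i≡1+m = ℕₚ.+-∸-assoc 1 i<D
    lemma : ∀ s t u v → s * (v * t) + u * (s * t) ≡ (u + v) * (s * t)
    lemma = solve-∀
  ... | no i≮D = begin
    s * (+ v * t) + + u * w ≡⟨ cong (λ n → s * (+ n * t) + + u * w) v≡0 ⟩
    s * (0ℤ * t) + + u * w  ≡⟨ lemma s t (+ u * w) ⟩
    + u * w                 ≡⟨ cong (λ n → + n * w) (ℕₚ.+-identityʳ u) ⟨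
    + (u ℕ.+ 0) * w         ≡⟨ cong (λ n → + (u ℕ.+ n) * w) v≡0 ⟨
    + (u ℕ.+ v) * w         ∎
    where
    w = s ^ (D ∸ i)
    v≡0 : v ≡ 0
    v≡0 = k>n⇒nCk≡0 (s≤s (ℕₚ.≮⇒≥ i≮D))
    lemma : ∀ s t x → s * (0ℤ * t) + x ≡ x
    lemma = solve-∀

coeff-hassePower-high : ∀ a e {i} → e < i → coeff i (hassePower a e 0) ≡ 0ℤ
coeff-hassePower-high a zero    {suc i} _         = refl
coeff-hassePower-high a (suc e) {suc i} (s≤s e<i) =
  trans (coeff-mulLinear (suc i) a (hassePower a e 0))
        (trans (cong₂ (λ u v → a * u + v) (coeff-hassePower-high a e (ℕₚ.m<n⇒m<1+n e<i))
                                          (coeff-hassePower-high a e e<i))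
               (lemma a))
  where lemma : ∀ a → a * 0ℤ + 0ℤ ≡ 0ℤ
        lemma = solve-∀

coeff-hassePower-top : ∀ a e → coeff e (hassePower a e 0) ≡ 1ℤ
coeff-hassePower-top a zero    = refl
coeff-hassePower-top a (suc e) =
  trans (coeff-mulLinear (suc e) a (hassePower a e 0))
        (trans (cong₂ (λ u v → a * u + v) (coeff-hassePower-high a e (ℕₚ.n<1+n e))
                                          (coeff-hassePower-top a e))
               (lemma a))
  where lemma : ∀ a → a * 0ℤ + 1ℤ ≡ 1ℤ
        lemma = solve-∀

coeff-binomial : ∀ e i → coeff i (hassePower 1ℤ e 0) ≡ + (e C i)
coeff-binomial zero    zero    = refl
coeff-binomial zero    (suc i) = refl
coeff-binomial (suc e) zero    =
  trans (coeff-mulLinear 0 1ℤ (hassePower 1ℤ e 0))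
        (trans (cong (λ t → 1ℤ * t + 0ℤ) (coeff-binomial e 0)) refl)
coeff-binomial (suc e) (suc i) = begin
  coeff (suc i) (mulLinear 1ℤ (hassePower 1ℤ e 0))   ≡⟨ coeff-mulLinear (suc i) 1ℤ (hassePower 1ℤ e 0) ⟩
  1ℤ * coeff (suc i) (hassePower 1ℤ e 0) + coeff i (hassePower 1ℤ e 0)
    ≡⟨ cong₂ (λ u v → 1ℤ * u + v) (coeff-binomial e (suc i)) (coeff-binomial e i) ⟩
  1ℤ * + (e C suc i) + + (e C i)                       ≡⟨ lemma (+ (e C suc i)) (+ (e C i)) ⟩
  + (e C i) + + (e C suc i)                           ≡⟨ pos-+ (e C i) (e C suc i) ⟨
  + (e C i ℕ.+ e C suc i)                             ≡⟨ cong +_ (nCk+nC[k+1]≡[n+1]C[k+1] e i) ⟩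
  + (suc e C suc i)                                   ∎
  where
  open ≡-Reasoning
  lemma : ∀ u v → 1ℤ * u + v ≡ v + u
  lemma = solve-∀

-- linearOfPower ℓ D is the polynomial x ↦ ℓ((x + Y)^D), where ℓ acts on polynomials in Y
linearOfPower : (Poly → ℤ) → ℕ → Poly
linearOfPower ℓ zero    = [ ℓ [ 1ℤ ] ]
linearOfPower ℓ (suc D) = (0ℤ ∷ linearOfPower ℓ D) +ₚ linearOfPower (ℓ ∘ (0ℤ ∷_)) D

hasse-linearOfPower : ∀ {ℓ} → IsLinear ℓ → ∀ D a i → hasse (linearOfPower ℓ D) a i ≡ ℓ (hassePower a D i)
hasse-linearOfPower {ℓ} L zero a zero = lemma (ℓ [ 1ℤ ]) a
  where lemma : ∀ c a → c + a * 0ℤ ≡ c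
        lemma = solve-∀
hasse-linearOfPower {ℓ} L zero a (suc i) = trans (lemma a) (sym (linear-[] L))
  where lemma : ∀ a → 0ℤ + a * 0ℤ ≡ 0ℤ
        lemma = solve-∀
hasse-linearOfPower {ℓ} L (suc D) a zero = begin
  hasse ((0ℤ ∷ linearOfPower ℓ D) +ₚ linearOfPower ℓ′ D) a 0
    ≡⟨ hasse-+ₚ (0ℤ ∷ linearOfPower ℓ D) (linearOfPower ℓ′ D) a 0 ⟩
  0ℤ + a * hasse (linearOfPower ℓ D) a 0 + hasse (linearOfPower ℓ′ D) a 0
    ≡⟨ cong₂ (λ s t → 0ℤ + a * s + t) (hasse-linearOfPower L D a 0)
                                     (hasse-linearOfPower (linear-∘X L) D a 0) ⟩
  0ℤ + a * ℓ Z + ℓ (0ℤ ∷ Z)   ≡⟨ cong (_+ ℓ (0ℤ ∷ Z)) (+-identityˡ (a * ℓ Z)) ⟩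
  a * ℓ Z + ℓ (0ℤ ∷ Z)        ≡⟨ cong (_+ ℓ (0ℤ ∷ Z)) (linear-·ₚ L a Z) ⟨
  ℓ (a ·ₚ Z) + ℓ (0ℤ ∷ Z)     ≡⟨ linear-+ₚ L (a ·ₚ Z) (0ℤ ∷ Z) ⟨
  ℓ (mulLinear a Z)           ∎
  where
  open ≡-Reasoning
  ℓ′ = ℓ ∘ (0ℤ ∷_)
  Z = hassePower a D 0
hasse-linearOfPower {ℓ} L (suc D) a (suc i) = begin
  hasse ((0ℤ ∷ linearOfPower ℓ D) +ₚ linearOfPower ℓ′ D) a (suc i)
    ≡⟨ hasse-+ₚ (0ℤ ∷ linearOfPower ℓ D) (linearOfPower ℓ′ D) a (suc i) ⟩
  hasse (linearOfPower ℓ D) a i + a * hasse (linearOfPower ℓ D) a (suc i) + hasse (linearOfPower ℓ′ D) a (suc i)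
    ≡⟨ cong₂ _+_ (cong₂ (λ s t → s + a * t) (hasse-linearOfPower L D a i) (hasse-linearOfPower L D a (suc i)))
                 (hasse-linearOfPower (linear-∘X L) D a (suc i)) ⟩
  ℓ Zᵢ + a * ℓ Z + ℓ (0ℤ ∷ Z)   ≡⟨ lemma a (ℓ Zᵢ) (ℓ Z) (ℓ (0ℤ ∷ Z)) ⟩
  a * ℓ Z + ℓ (0ℤ ∷ Z) + ℓ Zᵢ   ≡⟨ cong (λ t → t + ℓ (0ℤ ∷ Z) + ℓ Zᵢ) (linear-·ₚ L a Z) ⟨
  ℓ (a ·ₚ Z) + ℓ (0ℤ ∷ Z) + ℓ Zᵢ ≡⟨ cong (_+ ℓ Zᵢ) (linear-+ₚ L (a ·ₚ Z) (0ℤ ∷ Z)) ⟨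
  ℓ (mulLinear a Z) + ℓ Zᵢ       ≡⟨ linear-+ₚ L (mulLinear a Z) Zᵢ ⟨
  ℓ (mulLinear a Z +ₚ Zᵢ)        ∎
  where
  open ≡-Reasoning
  ℓ′ = ℓ ∘ (0ℤ ∷_)
  Z = hassePower a D (suc i)
  Zᵢ = hassePower a D i
  lemma : ∀ a u v w → u + a * v + w ≡ a * v + w + u
  lemma = solve-∀

-- Arithmetic modulo a prime

module _ (p : ℕ) (p-prime : Prime p) where

  infix 4 _≋_
  record _≋_ (x y : ℤ) : Set where
    constructor mod
    field divides-diff : + p ∣ℤ x - y

  ≡⇒≋ : ∀ {x y} → x ≡ y → x ≋ y
  ≡⇒≋ {x} refl = mod (dividesℤ 0ℤ (+-inverseʳ x))

  ≋-refl : ∀ {x} → x ≋ x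
  ≋-refl = ≡⇒≋ refl

  ≋-sym : ∀ {x y} → x ≋ y → y ≋ x
  ≋-sym {x} {y} (mod d) = mod (subst (+ p ∣ℤ_) (lemma x y) (ℤᵈ.∣m⇒∣-m d))
    where lemma : ∀ x y → - (x - y) ≡ y - x
          lemma = solve-∀

  ≋-trans : ∀ {x y z} → x ≋ y → y ≋ z → x ≋ z
  ≋-trans {x} {y} {z} (mod d) (mod e) = mod (subst (+ p ∣ℤ_) (lemma x y z) (ℤᵈ.∣m∣n⇒∣m+n d e))
    where lemma : ∀ x y z → (x - y) + (y - z) ≡ x - z
          lemma = solve-∀

  ≋-isEquivalence : IsEquivalence _≋_
  ≋-isEquivalence = record { refl = ≋-refl ; sym = ≋-sym ; trans = ≋-trans }

  ≋-setoid : Setoid 0ℓ 0ℓ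
  ≋-setoid = record { isEquivalence = ≋-isEquivalence }

  module ≋-Reasoning = SetoidReasoning ≋-setoid

  +-≋ : ∀ {x x′ y y′} → x ≋ x′ → y ≋ y′ → x + y ≋ x′ + y′
  +-≋ {x} {x′} {y} {y′} (mod d) (mod e) = mod (subst (+ p ∣ℤ_) (lemma x x′ y y′) (ℤᵈ.∣m∣n⇒∣m+n d e))
    where lemma : ∀ x x′ y y′ → (x - x′) + (y - y′) ≡ x + y - (x′ + y′)
          lemma = solve-∀

  neg-≋ : ∀ {x x′} → x ≋ x′ → - x ≋ - x′
  neg-≋ {x} {x′} (mod d) = mod (subst (+ p ∣ℤ_) (lemma x x′) (ℤᵈ.∣m⇒∣-m d))
    where lemma : ∀ x x′ → - (x - x′) ≡ - x - - x′
          lemma = solve-∀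

  -‿≋ : ∀ {x x′ y y′} → x ≋ x′ → y ≋ y′ → x - y ≋ x′ - y′
  -‿≋ x≋x′ y≋y′ = +-≋ x≋x′ (neg-≋ y≋y′)

  *-≋ : ∀ {x x′ y y′} → x ≋ x′ → y ≋ y′ → x * y ≋ x′ * y′
  *-≋ {x} {x′} {y} {y′} (mod d) (mod e) =
    mod (subst (+ p ∣ℤ_) (lemma x x′ y y′)
               (ℤᵈ.∣m∣n⇒∣m+n (ℤᵈ.∣n⇒∣m*n x e) (ℤᵈ.∣m⇒∣m*n y′ d)))
    where lemma : ∀ x x′ y y′ → x * (y - y′) + (x - x′) * y′ ≡ x * y - x′ * y′
          lemma = solve-∀

  ^-≋ : ∀ {x x′} n → x ≋ x′ → x ^ n ≋ x′ ^ n
  ^-≋ zero    x≋x′ = ≋-refl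
  ^-≋ (suc n) x≋x′ = *-≋ x≋x′ (^-≋ n x≋x′)

  ≋0⇒∣ : ∀ {x} → x ≋ 0ℤ → + p ∣ℤ x
  ≋0⇒∣ {x} (mod d) = subst (+ p ∣ℤ_) (+-identityʳ x) d

  ∣⇒≋0 : ∀ {x} → + p ∣ℤ x → x ≋ 0ℤ
  ∣⇒≋0 {x} d = mod (subst (+ p ∣ℤ_) (sym (+-identityʳ x)) d)

  ≋⇒-≋0 : ∀ {x y} → x ≋ y → x - y ≋ 0ℤ
  ≋⇒-≋0 (mod d) = ∣⇒≋0 d

  -≋0⇒≋ : ∀ {x y} → x - y ≋ 0ℤ → x ≋ y
  -≋0⇒≋ h = mod (≋0⇒∣ h)

  ≋0? : ∀ x → Dec (x ≋ 0ℤ)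
  ≋0? x with p ∣? ∣ x ∣
  ... | yes p∣x = yes (∣⇒≋0 (∣ᵤ⇒∣ p∣x))
  ... | no  p∤x = no (p∤x ∘ ∣⇒∣ᵤ ∘ ≋0⇒∣)

  ≋? : ∀ x y → Dec (x ≋ y)
  ≋? x y = Dec.map′ -≋0⇒≋ ≋⇒-≋0 (≋0? (x - y))

  *≋0⇒≋0⊎≋0 : ∀ {x y} → x * y ≋ 0ℤ → x ≋ 0ℤ ⊎ y ≋ 0ℤ
  *≋0⇒≋0⊎≋0 {x} {y} xy≋0
    with euclidsLemma ∣ x ∣ ∣ y ∣ p-prime (subst (p ∣_) (abs-* x y) (∣⇒∣ᵤ (≋0⇒∣ xy≋0)))
  ... | inj₁ p∣x = inj₁ (∣⇒≋0 (∣ᵤ⇒∣ p∣x))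
  ... | inj₂ p∣y = inj₂ (∣⇒≋0 (∣ᵤ⇒∣ p∣y))

  *≋0-cancelˡ : ∀ {x y} → ¬ x ≋ 0ℤ → x * y ≋ 0ℤ → y ≋ 0ℤ
  *≋0-cancelˡ x≉0 xy≋0 = [ (λ x≋0 → ⊥-elim (x≉0 x≋0)) , id ]′ (*≋0⇒≋0⊎≋0 xy≋0)

  *-cancelˡ-≋ : ∀ {c x y} → ¬ c ≋ 0ℤ → c * x ≋ c * y → x ≋ y
  *-cancelˡ-≋ {c} {x} {y} c≉0 cx≋cy = -≋0⇒≋ (*≋0-cancelˡ c≉0 (begin
    c * (x - y)   ≡⟨ lemma c x y ⟩
    c * x - c * y ≈⟨ ≋⇒-≋0 cx≋cy ⟩
    0ℤ            ∎))
    where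
    open ≋-Reasoning
    lemma : ∀ c x y → c * (x - y) ≡ c * x - c * y
    lemma = solve-∀

  1<p : 1 < p
  1<p = nonTrivial⇒n>1 p {{prime⇒nonTrivial p-prime}}

  0<p : 0 < p
  0<p = ℕₚ.<-trans (s≤s z≤n) 1<p

  p∤ : ∀ {m} → 0 < m → m < p → ¬ p ∣ m
  p∤ {suc m} _ m<p p∣m = ℕₚ.<-irrefl refl (ℕₚ.<-≤-trans m<p (∣⇒≤ p∣m))

  1≉0 : ¬ 1ℤ ≋ 0ℤ
  1≉0 1≋0 = p∤ (s≤s z≤n) 1<p (∣⇒∣ᵤ (≋0⇒∣ 1≋0))

  +≋0⇒∣ : ∀ {m} → + m ≋ 0ℤ → p ∣ m
  +≋0⇒∣ m≋0 = ∣⇒∣ᵤ (≋0⇒∣ m≋0)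

  ∣⇒+≋0 : ∀ {m} → p ∣ m → + m ≋ 0ℤ
  ∣⇒+≋0 p∣m = ∣⇒≋0 (∣ᵤ⇒∣ p∣m)

  private
    ≤-+≋+⇒≡ : ∀ {m n} → n ≤ m → m < p → + m ≋ + n → m ≡ n
    ≤-+≋+⇒≡ {m} {n} n≤m m<p (mod d)
      with m ∸ n in eq | ∣⇒∣ᵤ (subst (+ p ∣ℤ_) (trans (m-n≡m⊖n m n) (⊖-≥ n≤m)) d)
    ... | zero  | _   = ℕₚ.≤-antisym (ℕₚ.m∸n≡0⇒m≤n eq) n≤m
    ... | suc k | p∣k =
      ⊥-elim (p∤ (s≤s z≤n) (ℕₚ.≤-<-trans (subst (_≤ m) eq (ℕₚ.m∸n≤m m n)) m<p) p∣k)

  +≋+⇒≡ : ∀ {m n} → m < p → n < p → + m ≋ + n → m ≡ n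
  +≋+⇒≡ {m} {n} m<p n<p m≋n with ℕₚ.≤-total n m
  ... | inj₁ n≤m = ≤-+≋+⇒≡ n≤m m<p m≋n
  ... | inj₂ m≤n = sym (≤-+≋+⇒≡ m≤n n<p (≋-sym m≋n))

  toℤ : Fin p → ℤ
  toℤ x = + toℕ x

  toℤ-injective : ∀ {x y} → toℤ x ≋ toℤ y → x ≡ y
  toℤ-injective {x} {y} x≋y = toℕ-injective (+≋+⇒≡ (toℕ<n x) (toℕ<n y) x≋y)

  private
    synDiv-cong-at : ∀ {q q′ u b} → ¬ u ≋ b → eval q u ≋ eval q′ u → eval q b ≋ eval q′ b →
                     eval (synDiv q b) u ≋ eval (synDiv q′ b) u
    synDiv-cong-at {q} {q′} {u} {b} u≉b qu≋q′u qb≋q′b =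
      *-cancelˡ-≋ (u≉b ∘ -≋0⇒≋) (begin
        (u - b) * eval (synDiv q b) u   ≡⟨ quotient q ⟩
        eval q u - eval q b             ≈⟨ -‿≋ qu≋q′u qb≋q′b ⟩
        eval q′ u - eval q′ b           ≡⟨ quotient q′ ⟨
        (u - b) * eval (synDiv q′ b) u  ∎)
      where
      open ≋-Reasoning
      lemma : ∀ s t w → s * t ≡ s * t + w - w
      lemma = solve-∀
      quotient : ∀ r → (u - b) * eval (synDiv r b) u ≡ eval r u - eval r b
      quotient r = trans (lemma (u - b) (eval (synDiv r b) u) (eval r b))
                         (cong (_- eval r b) (sym (eval-synDiv r u b)))

    synDiv-cong-on : ∀ q q′ b us → eval q b ≋ eval q′ b → All (λ u → ¬ b ≋ u) us →
                     All (λ u → eval q u ≋ eval q′ u) us →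
                     All (λ u → eval (synDiv q b) u ≋ eval (synDiv q′ b) u) us
    synDiv-cong-on q q′ b []       qb≋q′b []            []          = []
    synDiv-cong-on q q′ b (u ∷ us) qb≋q′b (b≉u ∷ b≉us) (h ∷ hs) =
      synDiv-cong-at {q} {q′} (b≉u ∘ ≋-sym) h qb≋q′b ∷ synDiv-cong-on q q′ b us qb≋q′b b≉us hs

  Distinct : List ℤ → Set
  Distinct = AllPairs (λ u v → ¬ u ≋ v)

  divDiff-cong : ∀ b bs q q′ → Distinct (b ∷ bs) → All (λ u → eval q u ≋ eval q′ u) (b ∷ bs) →
                 divDiff b bs q ≋ divDiff b bs q′
  divDiff-cong b []        q q′ _               (h ∷ _)   = h
  divDiff-cong b (b′ ∷ bs) q q′ (b≉ ∷ distinct) (hb ∷ hs) =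
    divDiff-cong b′ bs (synDiv q b) (synDiv q′ b) distinct (synDiv-cong-on q q′ b (b′ ∷ bs) hb b≉ hs)

  DegreeBelow : ℕ → Poly → Set
  DegreeBelow n q = ∀ j → n ≤ j → coeff j q ≋ 0ℤ

  private
    degreeBelow-tail : ∀ {n c cs} → DegreeBelow (suc n) (c ∷ cs) → DegreeBelow n cs
    degreeBelow-tail deg j n≤j = deg (suc j) (s≤s n≤j)

  eval-degreeBelow-0 : ∀ q x → DegreeBelow 0 q → eval q x ≋ 0ℤ
  eval-degreeBelow-0 []       x deg = ≋-refl
  eval-degreeBelow-0 (c ∷ cs) x deg = begin
    c + x * eval cs x ≈⟨ +-≋ (deg 0 z≤n) (*-≋ (≋-refl {x}) tail≋0) ⟩
    0ℤ + x * 0ℤ       ≡⟨ lemma x ⟩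
    0ℤ                ∎
    where
    open ≋-Reasoning
    tail≋0 : eval cs x ≋ 0ℤ
    tail≋0 = eval-degreeBelow-0 cs x (λ j _ → deg (suc j) z≤n)
    lemma : ∀ x → 0ℤ + x * 0ℤ ≡ 0ℤ
    lemma = solve-∀

  eval-degreeBelow-1 : ∀ q x → DegreeBelow 1 q → eval q x ≋ coeff 0 q
  eval-degreeBelow-1 []       x deg = ≋-refl
  eval-degreeBelow-1 (c ∷ cs) x deg = begin
    c + x * eval cs x ≈⟨ +-≋ (≋-refl {c}) (*-≋ (≋-refl {x}) (eval-degreeBelow-0 cs x (degreeBelow-tail deg))) ⟩
    c + x * 0ℤ        ≡⟨ lemma c x ⟩
    c                 ∎
    where
    open ≋-Reasoning
    lemma : ∀ c x → c + x * 0ℤ ≡ c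
    lemma = solve-∀

  synDiv-degreeBelow : ∀ n q a → DegreeBelow (suc n) q → DegreeBelow n (synDiv q a)
  synDiv-degreeBelow n       []           a deg j       _         = ≋-refl
  synDiv-degreeBelow n       (c ∷ [])     a deg j       _         = ≋-refl
  synDiv-degreeBelow zero    (c ∷ d ∷ ds) a deg zero    _         = eval-degreeBelow-0 (d ∷ ds) a (degreeBelow-tail deg)
  synDiv-degreeBelow zero    (c ∷ d ∷ ds) a deg (suc j) _         =
    synDiv-degreeBelow zero (d ∷ ds) a (λ i _ → degreeBelow-tail deg i z≤n) j z≤n
  synDiv-degreeBelow (suc n) (c ∷ d ∷ ds) a deg (suc j) (s≤s n≤j) =
    synDiv-degreeBelow n (d ∷ ds) a (degreeBelow-tail deg) j n≤j

  coeff-synDiv-top : ∀ n q a → DegreeBelow (suc (suc n)) q → coeff n (synDiv q a) ≋ coeff (suc n) q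
  coeff-synDiv-top n       []           a deg = ≋-refl
  coeff-synDiv-top n       (c ∷ [])     a deg = ≋-refl
  coeff-synDiv-top zero    (c ∷ d ∷ ds) a deg = eval-degreeBelow-1 (d ∷ ds) a (degreeBelow-tail deg)
  coeff-synDiv-top (suc n) (c ∷ d ∷ ds) a deg = coeff-synDiv-top n (d ∷ ds) a (degreeBelow-tail deg)

  divDiff-leadingCoeff : ∀ b bs q → DegreeBelow (suc (length bs)) q → divDiff b bs q ≋ coeff (length bs) q
  divDiff-leadingCoeff b []        q deg = eval-degreeBelow-1 q b deg
  divDiff-leadingCoeff b (b′ ∷ bs) q deg =
    ≋-trans (divDiff-leadingCoeff b′ bs (synDiv q b) (synDiv-degreeBelow (suc (length bs)) q b deg))
            (coeff-synDiv-top (length bs) q b deg)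

  eval-coeff-cong : ∀ q q′ y → (∀ j → coeff j q ≋ coeff j q′) → eval q y ≋ eval q′ y
  eval-coeff-cong []       []         y h = ≋-refl
  eval-coeff-cong []       (c′ ∷ cs′) y h = ≋-sym (eval-degreeBelow-0 (c′ ∷ cs′) y (λ j _ → ≋-sym (h j)))
  eval-coeff-cong (c ∷ cs) []         y h = eval-degreeBelow-0 (c ∷ cs) y (λ j _ → h j)
  eval-coeff-cong (c ∷ cs) (c′ ∷ cs′) y h = +-≋ (h 0) (*-≋ (≋-refl {y}) (eval-coeff-cong cs cs′ y (h ∘ suc)))

  distinctRoots-bound : ∀ n q → DegreeBelow (suc n) q → ¬ coeff n q ≋ 0ℤ →
                        ∀ ys → Distinct ys → All (λ y → eval q y ≋ 0ℤ) ys → length ys ≤ n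
  distinctRoots-bound n q deg lead≉0 ys distinct roots with length ys ℕₚ.≤? n
  ... | yes ok = ok
  ... | no  n<ys = ⊥-elim (contradiction (take (suc n) ys) length-take′
                                         (AllPairsₚ.take⁺ (suc n) distinct) (Allₚ.take⁺ (suc n) roots))
    where
    length-take′ : length (take (suc n) ys) ≡ suc n
    length-take′ = trans (length-take (suc n) ys) (ℕₚ.m≤n⇒m⊓n≡m (ℕₚ.≰⇒> n<ys))
    contradiction : ∀ zs → length zs ≡ suc n → Distinct zs → All (λ y → eval q y ≋ 0ℤ) zs → ⊥
    contradiction (b ∷ bs) refl distinct roots = lead≉0 (begin
      coeff (length bs) q ≈⟨ divDiff-leadingCoeff b bs q deg ⟨
      divDiff b bs q      ≈⟨ divDiff-cong b bs q [] distinct roots ⟩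
      divDiff b bs []     ≡⟨ linear-[] (divDiff-linear b bs) ⟩
      0ℤ                  ∎)
      where open ≋-Reasoning

  -- Roots counted with multiplicity

  multiplicity : Fin p → List (Fin p) → ℕ
  multiplicity x []       = 0
  multiplicity x (y ∷ ys) with x ≟ᶠ y
  ... | yes _ = suc (multiplicity x ys)
  ... | no  _ = multiplicity x ys

  multiplicity-here : ∀ x ys → multiplicity x (x ∷ ys) ≡ suc (multiplicity x ys)
  multiplicity-here x ys with x ≟ᶠ x
  ... | yes _   = refl
  ... | no  x≢x = ⊥-elim (x≢x refl)

  multiplicity-there : ∀ {x y} ys → x ≢ y → multiplicity x (y ∷ ys) ≡ multiplicity x ys
  multiplicity-there {x} {y} ys x≢y with x ≟ᶠ y
  ... | yes x≡y = ⊥-elim (x≢y x≡y)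
  ... | no  _   = refl

  multiplicity-take : ∀ x k ys → multiplicity x (take k ys) ≤ multiplicity x ys
  multiplicity-take x zero    ys       = z≤n
  multiplicity-take x (suc k) []       = z≤n
  multiplicity-take x (suc k) (y ∷ ys) with x ≟ᶠ y
  ... | yes _ = s≤s (multiplicity-take x k ys)
  ... | no  _ = multiplicity-take x k ys

  VanishesTo : Poly → ℤ → ℕ → Set
  VanishesTo q a n = ∀ i → i < n → hasse q a i ≋ 0ℤ

  vanishesTo-mono : ∀ {q a m n} → m ≤ n → VanishesTo q a n → VanishesTo q a m
  vanishesTo-mono m≤n vanish i i<m = vanish i (ℕₚ.<-≤-trans i<m m≤n)

  private
    factor-≋0 : ∀ {u v E Gu Gv} → ¬ u ≋ v → Gu ≡ (u - v) * E + Gv → Gu ≋ 0ℤ → Gv ≋ 0ℤ → E ≋ 0ℤ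
    factor-≋0 {u} {v} {E} {Gu} {Gv} u≉v Gu≡ Gu≋0 Gv≋0 = *≋0-cancelˡ (u≉v ∘ -≋0⇒≋) (begin
      (u - v) * E            ≡⟨ lemma (u - v) E Gv ⟩
      (u - v) * E + Gv - Gv  ≡⟨ cong (_- Gv) Gu≡ ⟨
      Gu - Gv                ≈⟨ -‿≋ Gu≋0 Gv≋0 ⟩
      0ℤ                     ∎)
      where
      open ≋-Reasoning
      lemma : ∀ s E w → s * E ≡ s * E + w - w
      lemma = solve-∀

    synDivⁿ-root : ∀ q x b n → VanishesTo q x n → eval q b ≋ 0ℤ → ¬ x ≋ b →
                   ∀ i → i ≤ n → eval (synDivⁿ i q x) b ≋ 0ℤ
    synDivⁿ-root q x b n vanish qb≋0 x≉b zero    _   = qb≋0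
    synDivⁿ-root q x b n vanish qb≋0 x≉b (suc i) i<n =
      subst (λ r → eval r b ≋ 0ℤ) (sym (synDivⁿ-suc i q x))
        (factor-≋0 (x≉b ∘ ≋-sym) (eval-synDiv (synDivⁿ i q x) b x)
                   (synDivⁿ-root q x b n vanish qb≋0 x≉b i (ℕₚ.<⇒≤ i<n))
                   (subst (_≋ 0ℤ) (sym (eval-synDivⁿ i q x)) (vanish i i<n)))

  synDiv-vanishesTo : ∀ q x b n → VanishesTo q x n → eval q b ≋ 0ℤ → ¬ x ≋ b → VanishesTo (synDiv q b) x n
  synDiv-vanishesTo q x b n vanish qb≋0 x≉b i i<n =
    subst (_≋ 0ℤ) (trans (cong (λ r → eval r x) (sym (synDivⁿ-synDiv-comm i q x b)))
                         (eval-synDivⁿ i (synDiv q b) x))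
      (factor-≋0 x≉b (eval-synDiv (synDivⁿ i q x) x b)
                 (subst (_≋ 0ℤ) (sym (eval-synDivⁿ i q x)) (vanish i i<n))
                 (synDivⁿ-root q x b n vanish qb≋0 x≉b i (ℕₚ.<⇒≤ i<n)))

  divDiff-vanishesTo : ∀ b bs q → (∀ x → VanishesTo q (toℤ x) (multiplicity x (b ∷ bs))) →
                       divDiff (toℤ b) (map toℤ bs) q ≋ 0ℤ
  divDiff-vanishesTo b []        q vanish =
    subst (_≋ 0ℤ) (hasse-zero q (toℤ b)) (vanish b 0 (subst (0 <_) (sym (multiplicity-here b [])) (s≤s z≤n)))
  divDiff-vanishesTo b (b′ ∷ bs) q vanish = divDiff-vanishesTo b′ bs (synDiv q (toℤ b)) vanish′
    where
    qb≋0 : eval q (toℤ b) ≋ 0ℤ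
    qb≋0 = subst (_≋ 0ℤ) (hasse-zero q (toℤ b))
                 (vanish b 0 (subst (0 <_) (sym (multiplicity-here b (b′ ∷ bs))) (s≤s z≤n)))
    vanish′ : ∀ x → VanishesTo (synDiv q (toℤ b)) (toℤ x) (multiplicity x (b′ ∷ bs))
    vanish′ x with x ≟ᶠ b
    ... | yes refl = λ i i<m → subst (_≋ 0ℤ) (sym (hasse-synDiv q (toℤ b) i))
                       (vanish b (suc i) (subst (suc i <_) (sym (multiplicity-here b (b′ ∷ bs))) (s≤s i<m)))
    ... | no  x≢b  = synDiv-vanishesTo q (toℤ x) (toℤ b) _
                       (subst (VanishesTo q (toℤ x)) (multiplicity-there (b′ ∷ bs) x≢b) (vanish x))
                       qb≋0 (x≢b ∘ toℤ-injective)

  roots-bound : ∀ n q → DegreeBelow (suc n) q → ¬ coeff n q ≋ 0ℤ →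
                ∀ ys → (∀ x → VanishesTo q (toℤ x) (multiplicity x ys)) → length ys ≤ n
  roots-bound n q deg lead≉0 ys vanish with length ys ℕₚ.≤? n
  ... | yes ok = ok
  ... | no  n<ys = ⊥-elim (contradiction (take (suc n) ys) length-take′
                             (λ x → vanishesTo-mono {q} (multiplicity-take x (suc n) ys) (vanish x)))
    where
    length-take′ : length (take (suc n) ys) ≡ suc n
    length-take′ = trans (length-take (suc n) ys) (ℕₚ.m≤n⇒m⊓n≡m (ℕₚ.≰⇒> n<ys))
    contradiction : ∀ zs → length zs ≡ suc n → (∀ x → VanishesTo q (toℤ x) (multiplicity x zs)) → ⊥
    contradiction (b ∷ bs) len vanish′ = lead≉0 (begin
      coeff n q                          ≡⟨ cong (λ m → coeff m q) len′ ⟨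
      coeff (length (map toℤ bs)) q      ≈⟨ divDiff-leadingCoeff (toℤ b) (map toℤ bs) q deg′ ⟨
      divDiff (toℤ b) (map toℤ bs) q     ≈⟨ divDiff-vanishesTo b bs q vanish′ ⟩
      0ℤ                                 ∎)
      where
      open ≋-Reasoning
      len′ : length (map toℤ bs) ≡ n
      len′ = trans (length-map toℤ bs) (ℕₚ.suc-injective len)
      deg′ : DegreeBelow (suc (length (map toℤ bs))) q
      deg′ = subst (λ m → DegreeBelow (suc m) q) (sym len′) deg

  repeated : (Fin p → ℕ) → List (Fin p) → List (Fin p)
  repeated m = concatMap (λ a → replicate (m a) a)

  private
    multiplicity-++ : ∀ x xs ys → multiplicity x (xs ++ ys) ≡ multiplicity x xs ℕ.+ multiplicity x ys
    multiplicity-++ x []       ys = refl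
    multiplicity-++ x (y ∷ xs) ys with x ≟ᶠ y
    ... | yes _ = cong suc (multiplicity-++ x xs ys)
    ... | no  _ = multiplicity-++ x xs ys

    multiplicity-replicate-≡ : ∀ x n → multiplicity x (replicate n x) ≡ n
    multiplicity-replicate-≡ x zero    = refl
    multiplicity-replicate-≡ x (suc n) =
      trans (multiplicity-here x (replicate n x)) (cong suc (multiplicity-replicate-≡ x n))

    multiplicity-replicate-≢ : ∀ {x a} n → x ≢ a → multiplicity x (replicate n a) ≡ 0
    multiplicity-replicate-≢ zero    _   = refl
    multiplicity-replicate-≢ (suc n) x≢a =
      trans (multiplicity-there (replicate n _) x≢a) (multiplicity-replicate-≢ n x≢a)

    multiplicity-repeated-∉ : ∀ m x as → All (x ≢_) as → multiplicity x (repeated m as) ≡ 0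
    multiplicity-repeated-∉ m x []       []           = refl
    multiplicity-repeated-∉ m x (a ∷ as) (x≢a ∷ x∉as) =
      trans (multiplicity-++ x (replicate (m a) a) (repeated m as))
            (cong₂ ℕ._+_ (multiplicity-replicate-≢ (m a) x≢a) (multiplicity-repeated-∉ m x as x∉as))

    vanishesTo-repeated : ∀ q m as → Unique as → (∀ {a} → a ∈ as → VanishesTo q (toℤ a) (m a)) →
                          ∀ x → VanishesTo q (toℤ x) (multiplicity x (repeated m as))
    vanishesTo-repeated q m []       _              _      x i ()
    vanishesTo-repeated q m (a ∷ as) (a∉as ∷ uniq) vanish x with x ≟ᶠ a
    ... | yes refl = subst (VanishesTo q (toℤ a)) (sym multiplicity≡) (vanish (here refl))
      where
      multiplicity≡ : multiplicity a (repeated m (a ∷ as)) ≡ m a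
      multiplicity≡ = begin
        multiplicity a (replicate (m a) a ++ repeated m as)
          ≡⟨ multiplicity-++ a (replicate (m a) a) (repeated m as) ⟩
        multiplicity a (replicate (m a) a) ℕ.+ multiplicity a (repeated m as)
          ≡⟨ cong₂ ℕ._+_ (multiplicity-replicate-≡ a (m a)) (multiplicity-repeated-∉ m a as a∉as) ⟩
        m a ℕ.+ 0
          ≡⟨ ℕₚ.+-identityʳ (m a) ⟩
        m a ∎
        where open ≡-Reasoning
    ... | no  x≢a  = subst (VanishesTo q (toℤ x))
          (sym (trans (multiplicity-++ x (replicate (m a) a) (repeated m as))
                      (cong (ℕ._+ _) (multiplicity-replicate-≢ (m a) x≢a))))
          (vanishesTo-repeated q m as uniq (vanish ∘ there) x)

    length-repeated : ∀ m as → length (repeated m as) ≡ sum (map m as)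
    length-repeated m []       = refl
    length-repeated m (a ∷ as) =
      trans (length-++ (replicate (m a) a)) (cong₂ ℕ._+_ (length-replicate (m a)) (length-repeated m as))

  multiplicities-bound : ∀ n q → DegreeBelow (suc n) q → ¬ coeff n q ≋ 0ℤ →
                         ∀ m as → Unique as → (∀ {a} → a ∈ as → VanishesTo q (toℤ a) (m a)) →
                         sum (map m as) ≤ n
  multiplicities-bound n q deg lead≉0 m as uniq vanish =
    subst (_≤ n) (length-repeated m as)
      (roots-bound n q deg lead≉0 (repeated m as) (vanishesTo-repeated q m as uniq vanish))

  -- Fermat's little theorem

  p∤! : ∀ {m} → m < p → ¬ p ∣ m !
  p∤! {zero}  _   p∣1   = p∤ (s≤s z≤n) 1<p p∣1
  p∤! {suc m} m<p p∣m!′ with euclidsLemma (suc m) (m !) p-prime p∣m!′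
  ... | inj₁ p∣m  = p∤ (s≤s z≤n) m<p p∣m
  ... | inj₂ p∣m! = p∤! (ℕₚ.<-trans (ℕₚ.n<1+n m) m<p) p∣m!

  private
    C*!*!≡! : ∀ {n k} → k ≤ n → (n C k) ℕ.* (k ! ℕ.* (n ∸ k) !) ≡ n !
    C*!*!≡! {n} {k} k≤n =
      trans (cong (ℕ._* (k ! ℕ.* (n ∸ k) !)) (nCk≡n!/k![n-k]! k≤n))
            (m/n*n≡m {{k !* (n ∸ k) !≢0}} (k![n∸k]!∣n! k≤n))

    n∣n! : ∀ {n} → 0 < n → n ∣ n !
    n∣n! {suc n} _ = m∣m*n (n !)

    p∣pC*!*! : ∀ {k} → k < p → p ∣ (p C k) ℕ.* (k ! ℕ.* (p ∸ k) !)
    p∣pC*!*! k<p = subst (p ∣_) (sym (C*!*!≡! (ℕₚ.<⇒≤ k<p))) (n∣n! 0<p)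

  p∤C : ∀ {m k} → m < p → k ≤ m → ¬ p ∣ m C k
  p∤C {m} {k} m<p k≤m p∣C = p∤! m<p (subst (p ∣_) (C*!*!≡! k≤m) (∣m⇒∣m*n (k ! ℕ.* (m ∸ k) !) p∣C))

  p∣pC : ∀ {k} → 0 < k → k < p → p ∣ p C k
  p∣pC {k} 0<k k<p with euclidsLemma (p C k) (k ! ℕ.* (p ∸ k) !) p-prime (p∣pC*!*! k<p)
  ... | inj₁ p∣C   = p∣C
  ... | inj₂ p∣!*! with euclidsLemma (k !) ((p ∸ k) !) p-prime p∣!*!
  ...   | inj₁ p∣k!     = ⊥-elim (p∤! k<p p∣k!)
  ...   | inj₂ p∣[p-k]! = ⊥-elim (p∤! (ℕₚ.∸-monoʳ-< 0<k (ℕₚ.<⇒≤ k<p)) p∣[p-k]!)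

  0^-≡0 : ∀ {m} → 0 < m → 0ℤ ^ m ≡ 0ℤ
  0^-≡0 {suc m} _ = *-zeroˡ (0ℤ ^ m)

  frobenius-1+ : ∀ y → (1ℤ + y) ^ p ≋ 1ℤ + y ^ p
  frobenius-1+ y = begin
    (1ℤ + y) ^ p                            ≡⟨ *-identityˡ ((1ℤ + y) ^ p) ⟨
    1ℤ * (1ℤ + y) ^ p                       ≡⟨ eval-hassePower 1ℤ p 0 y ⟨
    eval (hassePower 1ℤ p 0) y              ≈⟨ eval-coeff-cong (hassePower 1ℤ p 0) 1+Xᵖ y coeff-≋ ⟩
    eval 1+Xᵖ y                             ≡⟨ eval-+ₚ [ 1ℤ ] (monomial p 1ℤ) y ⟩
    (1ℤ + y * 0ℤ) + eval (monomial p 1ℤ) y  ≡⟨ cong₂ _+_ (lemma y) (eval-monomial p 1ℤ y) ⟩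
    1ℤ + 1ℤ * y ^ p                         ≡⟨ cong (λ t → 1ℤ + t) (*-identityˡ (y ^ p)) ⟩
    1ℤ + y ^ p                              ∎
    where
    open ≋-Reasoning
    1+Xᵖ = [ 1ℤ ] +ₚ monomial p 1ℤ
    lemma : ∀ y → 1ℤ + y * 0ℤ ≡ 1ℤ
    lemma = solve-∀
    p≢0 : p ≢ 0
    p≢0 p≡0 = ℕₚ.<⇒≢ 0<p (sym p≡0)
    coeff-1+Xᵖ : ∀ j → + (p C j) ≋ coeff j [ 1ℤ ] + coeff j (monomial p 1ℤ)
    coeff-1+Xᵖ zero = ≡⇒≋ (cong (λ t → 1ℤ + t) (sym (coeff-monomial-≢ p 1ℤ (p≢0 ∘ sym))))
    coeff-1+Xᵖ (suc j) with ℕₚ.<-cmp (suc j) p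
    ... | tri< j<p _ _ = ≋-trans (∣⇒+≋0 (p∣pC (s≤s z≤n) j<p))
                                 (≡⇒≋ (sym (trans (+-identityˡ _) (coeff-monomial-≢ p 1ℤ (ℕₚ.<⇒≢ j<p)))))
    ... | tri≈ _ refl _ = ≡⇒≋ (trans (cong +_ (nCn≡1 p)) (sym (trans (+-identityˡ _) (coeff-monomial-≡ p 1ℤ))))
    ... | tri> _ _ j>p = ≡⇒≋ (trans (cong +_ (k>n⇒nCk≡0 j>p))
                                   (sym (trans (+-identityˡ _) (coeff-monomial-≢ p 1ℤ (ℕₚ.>⇒≢ j>p)))))
    coeff-≋ : ∀ j → coeff j (hassePower 1ℤ p 0) ≋ coeff j 1+Xᵖ
    coeff-≋ j = ≋-trans (≡⇒≋ (coeff-binomial p j))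
                        (≋-trans (coeff-1+Xᵖ j) (≡⇒≋ (sym (coeff-+ₚ j [ 1ℤ ] (monomial p 1ℤ)))))

  fermat : ∀ n → (+ n) ^ p ≋ + n
  fermat zero    = ≡⇒≋ (0^-≡0 0<p)
  fermat (suc n) = ≋-trans (frobenius-1+ (+ n)) (+-≋ (≋-refl {1ℤ}) (fermat n))

  fermat-unit : ∀ n → ¬ + n ≋ 0ℤ → (+ n) ^ (p ∸ 1) ≋ 1ℤ
  fermat-unit n n≉0 = *-cancelˡ-≋ n≉0 (begin
    + n * (+ n) ^ (p ∸ 1) ≡⟨ cong ((+ n) ^_) (ℕₚ.m+[n∸m]≡n (ℕₚ.<⇒≤ 1<p)) ⟩
    (+ n) ^ p             ≈⟨ fermat n ⟩
    + n                   ≡⟨ *-identityʳ (+ n) ⟨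
    + n * 1ℤ              ∎)
    where open ≋-Reasoning

  -- Roots of unity

  Distinct-map-toℤ : ∀ {ys} → Unique ys → Distinct (map toℤ ys)
  Distinct-map-toℤ = AllPairsₚ.map⁺ ∘ AllPairs.map (λ x≢y → x≢y ∘ toℤ-injective)

  powerRoots-bound : ∀ k → 0 < k → ∀ ys → Distinct ys → All (λ y → y ^ k ≋ 1ℤ) ys → length ys ≤ k
  powerRoots-bound k 0<k ys distinct roots =
    distinctRoots-bound k Xᵏ-1 degree lead≉0 ys distinct (All.map root roots)
    where
    Xᵏ-1 = [ - 1ℤ ] +ₚ monomial k 1ℤ
    degree : DegreeBelow (suc k) Xᵏ-1
    degree j k<j = ≡⇒≋ (begin
      coeff j Xᵏ-1                                    ≡⟨ coeff-+ₚ j [ - 1ℤ ] (monomial k 1ℤ) ⟩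
      coeff j [ - 1ℤ ] + coeff j (monomial k 1ℤ)      ≡⟨ cong₂ _+_ (coeff-const (- 1ℤ) (ℕₚ.≤-<-trans z≤n k<j))
                                                                   (coeff-monomial-≢ k 1ℤ (ℕₚ.>⇒≢ k<j)) ⟩
      0ℤ                                              ∎)
      where open ≡-Reasoning
    lead≉0 : ¬ coeff k Xᵏ-1 ≋ 0ℤ
    lead≉0 = 1≉0 ∘ ≋-trans (≡⇒≋ (sym (trans (coeff-+ₚ k [ - 1ℤ ] (monomial k 1ℤ))
                                           (cong₂ _+_ (coeff-const (- 1ℤ) 0<k) (coeff-monomial-≡ k 1ℤ)))))
    root : ∀ {y} → y ^ k ≋ 1ℤ → eval Xᵏ-1 y ≋ 0ℤ
    root {y} yᵏ≋1 = begin
      eval Xᵏ-1 y                               ≡⟨ eval-+ₚ [ - 1ℤ ] (monomial k 1ℤ) y ⟩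
      (- 1ℤ + y * 0ℤ) + eval (monomial k 1ℤ) y  ≡⟨ cong₂ _+_ (lemma y) (eval-monomial k 1ℤ y) ⟩
      - 1ℤ + 1ℤ * y ^ k                         ≈⟨ +-≋ (≋-refl { - 1ℤ}) (*-≋ (≋-refl {1ℤ}) yᵏ≋1) ⟩
      0ℤ                                        ∎
      where
      open ≋-Reasoning
      lemma : ∀ y → - 1ℤ + y * 0ℤ ≡ - 1ℤ
      lemma = solve-∀

  IsRootOfUnity : ℕ → Fin p → Set
  IsRootOfUnity d y = toℤ y ^ d ≋ 1ℤ

  isRootOfUnity? : ∀ d y → Dec (IsRootOfUnity d y)
  isRootOfUnity? d y = ≋? (toℤ y ^ d) 1ℤ

  μ : ℕ → List (Fin p)
  μ d = filter (isRootOfUnity? d) (allFin p)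

  μ-unique : ∀ d → Unique (μ d)
  μ-unique d = Uniqueₚ.filter⁺ (isRootOfUnity? d) (Uniqueₚ.allFin⁺ p)

  ∈μ⁺ : ∀ d {y} → IsRootOfUnity d y → y ∈ μ d
  ∈μ⁺ d {y} = ∈-filter⁺ (isRootOfUnity? d) (∈-allFin y)

  ∈μ⁻ : ∀ d {y} → y ∈ μ d → IsRootOfUnity d y
  ∈μ⁻ d y∈μ = proj₂ (∈-filter⁻ (isRootOfUnity? d) {xs = allFin p} y∈μ)

  μ-upper : ∀ d → 0 < d → length (μ d) ≤ d
  μ-upper d 0<d = subst (_≤ d) (length-map toℤ (μ d))
    (powerRoots-bound d 0<d (map toℤ (μ d)) (Distinct-map-toℤ (μ-unique d))
                      (Allₚ.map⁺ (Allₚ.all-filter (isRootOfUnity? d) (allFin p))))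

  -- the non-roots of unity are roots of X (X^(p-1) - 1) / (X^d - 1)
  μ-lower : ∀ d i → p ∸ 1 ≡ suc i ℕ.* d → d ≤ length (μ d)
  μ-lower d i p-1≡ = ℕₚ.+-cancelʳ-≤ (suc (i ℕ.* d)) d (length (μ d)) counting
    where
    nonRoots = filter (¬? ∘ isRootOfUnity? d) (allFin p)
    XQ = 0ℤ ∷ geometric d (suc i)
    Q : Fin p → ℤ
    Q y = eval (geometric d (suc i)) (toℤ y)
    0<d : 0 < d
    0<d = ℕₚ.n≢0⇒n>0 λ d≡0 → ℕₚ.<⇒≢ (ℕₚ.∸-monoˡ-< 1<p ℕₚ.≤-refl)
            (sym (trans p-1≡ (trans (cong (suc i ℕ.*_) d≡0) (ℕₚ.*-zeroʳ (suc i)))))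
    degree : DegreeBelow (suc (suc (i ℕ.* d))) XQ
    degree (suc j) (s≤s id<j) = ≡⇒≋ (coeff-geometric-high d i id<j)
    lead≉0 : ¬ coeff (suc (i ℕ.* d)) XQ ≋ 0ℤ
    lead≉0 = 1≉0 ∘ ≋-trans (≡⇒≋ (sym (coeff-geometric-top d i 0<d)))
    root : ∀ {y} → ¬ IsRootOfUnity d y → eval XQ (toℤ y) ≋ 0ℤ
    root {y} y∉μ with ≋0? (toℤ y)
    ... | yes y≋0 = ≋-trans (+-≋ (≋-refl {0ℤ}) (*-≋ y≋0 (≋-refl {Q y}))) (≡⇒≋ (lemma (Q y)))
      where lemma : ∀ t → 0ℤ + 0ℤ * t ≡ 0ℤ
            lemma = solve-∀
    ... | no  y≉0 = ≋-trans (+-≋ (≋-refl {0ℤ}) (*-≋ (≋-refl {toℤ y}) Q≋0)) (≡⇒≋ (lemma (toℤ y)))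
      where
      lemma : ∀ t → 0ℤ + t * 0ℤ ≡ 0ℤ
      lemma = solve-∀
      Q≋0 : eval (geometric d (suc i)) (toℤ y) ≋ 0ℤ
      Q≋0 = *≋0-cancelˡ (y∉μ ∘ -≋0⇒≋) (begin
        (toℤ y ^ d - 1ℤ) * eval (geometric d (suc i)) (toℤ y) ≡⟨ eval-geometric d (suc i) (toℤ y) ⟩
        toℤ y ^ (suc i ℕ.* d) - 1ℤ                           ≡⟨ cong (λ n → toℤ y ^ n - 1ℤ) p-1≡ ⟨
        toℤ y ^ (p ∸ 1) - 1ℤ                                 ≈⟨ ≋⇒-≋0 (fermat-unit (toℕ y) y≉0) ⟩
        0ℤ                                                   ∎)
        where open ≋-Reasoning
    nonRoots-bound : length nonRoots ≤ suc (i ℕ.* d)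
    nonRoots-bound = subst (_≤ suc (i ℕ.* d)) (length-map toℤ nonRoots)
      (distinctRoots-bound (suc (i ℕ.* d)) XQ degree lead≉0 (map toℤ nonRoots)
        (Distinct-map-toℤ (Uniqueₚ.filter⁺ (¬? ∘ isRootOfUnity? d) (Uniqueₚ.allFin⁺ p)))
        (Allₚ.map⁺ (All.map root (Allₚ.all-filter (¬? ∘ isRootOfUnity? d) (allFin p)))))
    counting : d ℕ.+ suc (i ℕ.* d) ≤ length (μ d) ℕ.+ suc (i ℕ.* d)
    counting = begin
      d ℕ.+ suc (i ℕ.* d)               ≡⟨ ℕₚ.+-suc d (i ℕ.* d) ⟩
      suc (suc i ℕ.* d)                 ≡⟨ cong suc p-1≡ ⟨
      suc (p ∸ 1)                       ≡⟨ ℕₚ.m+[n∸m]≡n (ℕₚ.<⇒≤ 1<p) ⟩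
      p                                 ≡⟨ length-tabulate id ⟨
      length (allFin p)                 ≡⟨ length-filter-split (isRootOfUnity? d) (allFin p) ⟩
      length (μ d) ℕ.+ length nonRoots  ≤⟨ ℕₚ.+-monoʳ-≤ (length (μ d)) nonRoots-bound ⟩
      length (μ d) ℕ.+ suc (i ℕ.* d)    ∎
      where open ℕₚ.≤-Reasoning

  private instance
    p-nonZero : NonZero p
    p-nonZero = prime⇒nonZero p-prime

  residue : ℕ → Fin p
  residue m = fromℕ< (m%n<n m p)

  toℤ-residue : ∀ m → toℤ (residue m) ≋ + m
  toℤ-residue m = mod (dividesℤ (- + (m / p)) (begin
    + toℕ (residue m) - + m                    ≡⟨ cong (λ r → + r - + m) (toℕ-fromℕ< (m%n<n m p)) ⟩
    + (m % p) - + m                            ≡⟨ cong (λ n → + (m % p) - + n) (m≡m%n+[m/n]*n m p) ⟩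
    + (m % p) - + (m % p ℕ.+ m / p ℕ.* p)      ≡⟨ cong (λ t → + (m % p) - t)
                                                   (trans (pos-+ (m % p) (m / p ℕ.* p))
                                                          (cong (λ t → + (m % p) + t) (pos-* (m / p) p))) ⟩
    + (m % p) - (+ (m % p) + + (m / p) * + p)  ≡⟨ lemma (+ (m % p)) (+ (m / p)) (+ p) ⟩
    - + (m / p) * + p                          ∎))
    where
    open ≡-Reasoning
    lemma : ∀ r q p → r - (r + q * p) ≡ - q * p
    lemma = solve-∀

  +sum-map-≋ : ∀ {A : Set} (f g : A → ℕ) c xs → (∀ x → + f x ≋ c * + g x) →
               + sum (map f xs) ≋ c * + sum (map g xs)
  +sum-map-≋ f g c []       _ = ≡⇒≋ (sym (*-zeroʳ c))
  +sum-map-≋ f g c (x ∷ xs) h = begin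
    + (f x ℕ.+ sum (map f xs))        ≡⟨ pos-+ (f x) (sum (map f xs)) ⟩
    + f x + + sum (map f xs)          ≈⟨ +-≋ (h x) (+sum-map-≋ f g c xs h) ⟩
    c * + g x + c * + sum (map g xs)  ≡⟨ *-distribˡ-+ c (+ g x) (+ sum (map g xs)) ⟨
    c * (+ g x + + sum (map g xs))    ≡⟨ cong (c *_) (pos-+ (g x) (sum (map g xs))) ⟨
    c * + (g x ℕ.+ sum (map g xs))    ∎
    where open ≋-Reasoning

  μ-powerSum : ∀ d k → 0 < k → k < d → d ≤ length (μ d) → + sum (map (λ y → toℕ y ℕ.^ k) (μ d)) ≋ 0ℤ
  μ-powerSum d k 0<k k<d d≤|μ| = *≋0-cancelˡ (ζᵏ≉1 ∘ -≋0⇒≋) (begin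
    (toℤ ζ ^ k - 1ℤ) * S  ≡⟨ lemma (toℤ ζ ^ k) S ⟩
    toℤ ζ ^ k * S - S     ≈⟨ -‿≋ (≋-sym rotation) (≋-refl {S}) ⟩
    S - S                 ≡⟨ +-inverseʳ S ⟩
    0ℤ                    ∎)
    where
    open ≋-Reasoning
    g : Fin p → ℕ
    g y = toℕ y ℕ.^ k
    S = + sum (map g (μ d))
    lemma : ∀ z s → (z - 1ℤ) * s ≡ z * s - s
    lemma = solve-∀

    -- some ζ ∈ μ_d has ζ^k ≠ 1, as X^k - 1 has fewer than d roots
    witness : ∃ λ ζ → ζ ∈ μ d × ¬ toℤ ζ ^ k ≋ 1ℤ
    witness with All.all? (λ y → ≋? (toℤ y ^ k) 1ℤ) (μ d)
    ... | yes all = ⊥-elim (ℕₚ.<⇒≱ k<d (ℕₚ.≤-trans d≤|μ| (subst (_≤ k) (length-map toℤ (μ d))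
                      (powerRoots-bound k 0<k (map toℤ (μ d)) (Distinct-map-toℤ (μ-unique d)) (Allₚ.map⁺ all)))))
    ... | no ¬all = find (¬All⇒Any¬ (λ y → ≋? (toℤ y ^ k) 1ℤ) (μ d) ¬all)

    ζ = proj₁ witness
    ζᵏ≉1 = proj₂ (proj₂ witness)
    ζᵈ≋1 : toℤ ζ ^ d ≋ 1ℤ
    ζᵈ≋1 = ∈μ⁻ d (proj₁ (proj₂ witness))

    ζ· : Fin p → Fin p
    ζ· c = residue (toℕ ζ ℕ.* toℕ c)

    toℤ-ζ· : ∀ c → toℤ (ζ· c) ≋ toℤ ζ * toℤ c
    toℤ-ζ· c = ≋-trans (toℤ-residue _) (≡⇒≋ (pos-* (toℕ ζ) (toℕ c)))

    ζ⁻¹· : Fin p → Fin p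
    ζ⁻¹· c = residue (toℕ ζ ℕ.^ (d ∸ 1) ℕ.* toℕ c)

    toℤ-ζ⁻¹· : ∀ c → toℤ (ζ⁻¹· c) ≋ toℤ ζ ^ (d ∸ 1) * toℤ c
    toℤ-ζ⁻¹· c = ≋-trans (toℤ-residue _)
      (≡⇒≋ (trans (pos-* (toℕ ζ ℕ.^ (d ∸ 1)) (toℕ c)) (cong (_* toℤ c) (pos-^ (toℕ ζ) (d ∸ 1)))))

    d-1+1 : suc (d ∸ 1) ≡ d
    d-1+1 = ℕₚ.m+[n∸m]≡n (ℕₚ.≤-trans 0<k (ℕₚ.<⇒≤ k<d))

    ζ·ζ⁻¹· : ∀ c → ζ· (ζ⁻¹· c) ≡ c
    ζ·ζ⁻¹· c = toℤ-injective (begin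
      toℤ (ζ· (ζ⁻¹· c))                   ≈⟨ toℤ-ζ· (ζ⁻¹· c) ⟩
      toℤ ζ * toℤ (ζ⁻¹· c)                ≈⟨ *-≋ (≋-refl {toℤ ζ}) (toℤ-ζ⁻¹· c) ⟩
      toℤ ζ * (toℤ ζ ^ (d ∸ 1) * toℤ c)   ≡⟨ *-assoc (toℤ ζ) (toℤ ζ ^ (d ∸ 1)) (toℤ c) ⟨
      toℤ ζ ^ suc (d ∸ 1) * toℤ c         ≡⟨ cong (λ n → toℤ ζ ^ n * toℤ c) d-1+1 ⟩
      toℤ ζ ^ d * toℤ c                   ≈⟨ *-≋ ζᵈ≋1 (≋-refl {toℤ c}) ⟩
      1ℤ * toℤ c                          ≡⟨ *-identityˡ (toℤ c) ⟩
      toℤ c                               ∎)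

    ζ⁻¹·-∈μ : ∀ {c} → c ∈ μ d → ζ⁻¹· c ∈ μ d
    ζ⁻¹·-∈μ {c} c∈μ = ∈μ⁺ d (begin
      toℤ (ζ⁻¹· c) ^ d                    ≈⟨ ^-≋ d (toℤ-ζ⁻¹· c) ⟩
      (toℤ ζ ^ (d ∸ 1) * toℤ c) ^ d       ≡⟨ ^-distribʳ-* (toℤ ζ ^ (d ∸ 1)) (toℤ c) d ⟩
      (toℤ ζ ^ (d ∸ 1)) ^ d * toℤ c ^ d   ≡⟨ cong (_* toℤ c ^ d) (^-comm (toℤ ζ) (d ∸ 1) d) ⟩
      (toℤ ζ ^ d) ^ (d ∸ 1) * toℤ c ^ d   ≈⟨ *-≋ (^-≋ (d ∸ 1) ζᵈ≋1) (∈μ⁻ d c∈μ) ⟩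
      1ℤ ^ (d ∸ 1) * 1ℤ                   ≡⟨ cong (_* 1ℤ) (^-zeroˡ (d ∸ 1)) ⟩
      1ℤ                                  ∎)

    rotation-↭ : map ζ· (μ d) ↭ μ d
    rotation-↭ = ⊇-length≤⇒↭ (map ζ· (μ d)) (μ d) (μ-unique d)
      (λ {c} c∈μ → subst (_∈ map ζ· (μ d)) (ζ·ζ⁻¹· c) (∈-map⁺ ζ· (ζ⁻¹·-∈μ c∈μ)))
      (ℕₚ.≤-reflexive (length-map ζ· (μ d)))

    rotation : S ≋ toℤ ζ ^ k * S
    rotation = begin
      + sum (map g (μ d))           ≡⟨ cong +_ (sum-↭ (↭-map⁺ g rotation-↭)) ⟨
      + sum (map g (map ζ· (μ d)))  ≡⟨ cong (λ ys → + sum ys) (map-∘ (μ d)) ⟨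
      + sum (map (g ∘ ζ·) (μ d))    ≈⟨ +sum-map-≋ (g ∘ ζ·) g (toℤ ζ ^ k) (μ d) rotate-term ⟩
      toℤ ζ ^ k * S                 ∎
      where
      rotate-term : ∀ c → + g (ζ· c) ≋ toℤ ζ ^ k * + g c
      rotate-term c = begin
        + g (ζ· c)               ≡⟨ pos-^ (toℕ (ζ· c)) k ⟩
        toℤ (ζ· c) ^ k           ≈⟨ ^-≋ k (toℤ-ζ· c) ⟩
        (toℤ ζ * toℤ c) ^ k      ≡⟨ ^-distribʳ-* (toℤ ζ) (toℤ c) k ⟩
        toℤ ζ ^ k * toℤ c ^ k    ≡⟨ cong (toℤ ζ ^ k *_) (pos-^ (toℕ c) k) ⟨
        toℤ ζ ^ k * + g c        ∎

  -- The Hanson–Petridis bound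

  RootOrZero : ℕ → ℤ → Set
  RootOrZero d s = s ^ d ≋ 1ℤ ⊎ s ≋ 0ℤ

  module HansonPetridis (d : ℕ) (0<d : 0 < d) (b₀ : Fin p) (bs : List (Fin p))
                        (B-unique : Unique (b₀ ∷ bs)) (d+e<p : d ℕ.+ length bs < p) where

    e : ℕ
    e = length bs

    D : ℕ
    D = d ℕ.+ e

    nodes : List ℤ
    nodes = map toℤ (b₀ ∷ bs)

    ℓ : Poly → ℤ
    ℓ = divDiff (toℤ b₀) (map toℤ bs)

    ℓ-linear : IsLinear ℓ
    ℓ-linear = divDiff-linear (toℤ b₀) (map toℤ bs)

    F : Poly
    F = linearOfPower ℓ D +ₚ [ - 1ℤ ]

    ℓ-leading : ∀ q → DegreeBelow (suc e) q → ℓ q ≋ coeff e q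
    ℓ-leading q deg = subst (λ n → ℓ q ≋ coeff n q) (length-map toℤ bs)
      (divDiff-leadingCoeff (toℤ b₀) (map toℤ bs) q
        (subst (λ n → DegreeBelow (suc n) q) (sym (length-map toℤ bs)) deg))

    ℓ-hassePower : ∀ α i t → t ≤ e →
                   All (λ b → eval (hassePower α D i) b ≋ + (D C i) * (α + b) ^ t) nodes →
                   ℓ (hassePower α D i) ≋ + (D C i) * coeff e (hassePower α t 0)
    ℓ-hassePower α i t t≤e on-nodes = begin
      ℓ (hassePower α D i)      ≈⟨ divDiff-cong (toℤ b₀) (map toℤ bs) _ _ (Distinct-map-toℤ B-unique)
                                                (All.map (λ {b} → agree b) on-nodes) ⟩
      ℓ (+ (D C i) ·ₚ [α+Y]ᵗ)   ≡⟨ linear-·ₚ ℓ-linear (+ (D C i)) [α+Y]ᵗ ⟩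
      + (D C i) * ℓ [α+Y]ᵗ      ≈⟨ *-≋ (≋-refl {+ (D C i)}) (ℓ-leading [α+Y]ᵗ degree) ⟩
      + (D C i) * coeff e [α+Y]ᵗ ∎
      where
      open ≋-Reasoning
      [α+Y]ᵗ = hassePower α t 0
      degree : DegreeBelow (suc e) [α+Y]ᵗ
      degree j e<j = ≡⇒≋ (coeff-hassePower-high α t (ℕₚ.<-≤-trans (s≤s t≤e) e<j))
      agree : ∀ b → eval (hassePower α D i) b ≋ + (D C i) * (α + b) ^ t →
              eval (hassePower α D i) b ≋ eval (+ (D C i) ·ₚ [α+Y]ᵗ) b
      agree b value = ≋-trans value (≡⇒≋ (sym (trans (eval-·ₚ (+ (D C i)) [α+Y]ᵗ b)
                        (cong (+ (D C i) *_) (trans (eval-hassePower α t 0 b) (*-identityˡ _))))))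

    -- ℓ only sees the nodes, where (α + b)^(d + (e - i)) may be replaced by (α + b)^(e - i) of degree ≤ e
    hasse-F : ∀ α i → i ≤ e → All (λ b → (α + b) ^ (d ℕ.+ (e ∸ i)) ≋ (α + b) ^ (e ∸ i)) nodes →
              hasse F α i ≋ 0ℤ
    hasse-F α i i≤e on-nodes = begin
      hasse F α i
        ≡⟨ hasse-+ₚ (linearOfPower ℓ D) [ - 1ℤ ] α i ⟩
      hasse (linearOfPower ℓ D) α i + hasse [ - 1ℤ ] α i
        ≡⟨ cong (_+ hasse [ - 1ℤ ] α i) (hasse-linearOfPower ℓ-linear D α i) ⟩
      ℓ (hassePower α D i) + hasse [ - 1ℤ ] α i
        ≈⟨ +-≋ (ℓ-hassePower α i (e ∸ i) (ℕₚ.m∸n≤m e i) (All.map value on-nodes)) (≋-refl {hasse [ - 1ℤ ] α i}) ⟩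
      + (D C i) * coeff e (hassePower α (e ∸ i) 0) + hasse [ - 1ℤ ] α i
        ≡⟨ leading-term i i≤e ⟩
      0ℤ ∎
      where
      open ≋-Reasoning
      value : ∀ {b} → (α + b) ^ (d ℕ.+ (e ∸ i)) ≋ (α + b) ^ (e ∸ i) →
              eval (hassePower α D i) b ≋ + (D C i) * (α + b) ^ (e ∸ i)
      value {b} shift = ≋-trans (≡⇒≋ (trans (eval-hassePower α D i b)
                                            (cong (λ n → + (D C i) * (α + b) ^ n) (ℕₚ.+-∸-assoc d i≤e))))
                                (*-≋ (≋-refl {+ (D C i)}) shift)
      leading-term : ∀ i → i ≤ e → + (D C i) * coeff e (hassePower α (e ∸ i) 0) + hasse [ - 1ℤ ] α i ≡ 0ℤ
      leading-term zero    _   =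
        trans (cong (λ c → 1ℤ * c + (- 1ℤ + α * 0ℤ)) (coeff-hassePower-top α e)) (lemma α)
        where lemma : ∀ α → 1ℤ * 1ℤ + (- 1ℤ + α * 0ℤ) ≡ 0ℤ
              lemma = solve-∀
      leading-term (suc i) i<e =
        trans (cong (λ c → + (D C suc i) * c + (0ℤ + α * 0ℤ))
                    (coeff-hassePower-high α (e ∸ suc i) (ℕₚ.∸-monoʳ-< (s≤s z≤n) i<e)))
              (lemma (+ (D C suc i)) α)
        where lemma : ∀ c α → c * 0ℤ + (0ℤ + α * 0ℤ) ≡ 0ℤ
              lemma = solve-∀

    shift-d : ∀ {s} t → s ^ d ≋ 1ℤ → s ^ (d ℕ.+ t) ≋ s ^ t
    shift-d {s} t sᵈ≋1 = begin
      s ^ (d ℕ.+ t)  ≡⟨ ^-distribˡ-+-* s d t ⟩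
      s ^ d * s ^ t  ≈⟨ *-≋ sᵈ≋1 (≋-refl {s ^ t}) ⟩
      1ℤ * s ^ t     ≡⟨ *-identityˡ (s ^ t) ⟩
      s ^ t          ∎
      where open ≋-Reasoning

    shift-d-suc : ∀ {s} t → RootOrZero d s → s ^ (d ℕ.+ suc t) ≋ s ^ suc t
    shift-d-suc t (inj₁ sᵈ≋1)    = shift-d (suc t) sᵈ≋1
    shift-d-suc {s} t (inj₂ s≋0) = begin
      s ^ (d ℕ.+ suc t)   ≡⟨ ^-distribˡ-+-* s d (suc t) ⟩
      s ^ d * s ^ suc t   ≈⟨ *-≋ (≋-refl {s ^ d}) sˢᵘᶜᵗ≋0 ⟩
      s ^ d * 0ℤ          ≡⟨ *-zeroʳ (s ^ d) ⟩
      0ℤ                  ≈⟨ sˢᵘᶜᵗ≋0 ⟨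
      s ^ suc t           ∎
      where
      open ≋-Reasoning
      sˢᵘᶜᵗ≋0 : s ^ suc t ≋ 0ℤ
      sˢᵘᶜᵗ≋0 = ≋-trans (*-≋ s≋0 (≋-refl {s ^ t})) (≡⇒≋ (*-zeroˡ (s ^ t)))

    Avoids : ℤ → Set
    Avoids α = All (λ b → ¬ α + b ≋ 0ℤ) nodes

    avoids? : ∀ α → Dec (Avoids α)
    avoids? α = All.all? (λ b → ¬? (≋0? (α + b))) nodes

    order : Fin p → ℕ
    order a = if does (avoids? (toℤ a)) then suc e else e

    F-vanishes : ∀ a → All (λ b → RootOrZero d (toℤ a + b)) nodes → VanishesTo F (toℤ a) (order a)
    F-vanishes a good = vanishes (avoids? (toℤ a))
      where
      vanishes : (avoids : Dec (Avoids (toℤ a))) → VanishesTo F (toℤ a) (if does avoids then suc e else e)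
      vanishes (yes avoids) i i≤e =
        hasse-F (toℤ a) i (ℕₚ.≤-pred i≤e) (All.zipWith (λ {b} → root {b}) (good , avoids))
        where root : ∀ {b} → RootOrZero d (toℤ a + b) × ¬ toℤ a + b ≋ 0ℤ →
                     (toℤ a + b) ^ (d ℕ.+ (e ∸ i)) ≋ (toℤ a + b) ^ (e ∸ i)
              root (inj₁ sᵈ≋1 , _)   = shift-d (e ∸ i) sᵈ≋1
              root (inj₂ s≋0  , s≉0) = ⊥-elim (s≉0 s≋0)
      vanishes (no _)       i i<e =
        hasse-F (toℤ a) i (ℕₚ.<⇒≤ i<e)
          (subst (λ n → All (λ b → (toℤ a + b) ^ (d ℕ.+ n) ≋ (toℤ a + b) ^ n) nodes)
                 (sym (ℕₚ.+-∸-assoc 1 i<e))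
                 (All.map (shift-d-suc (e ∸ suc i)) good))

    coeff-F : ∀ j → d ≤ j → coeff j F ≋ + (D C j) * coeff e (hassePower 0ℤ (D ∸ j) 0)
    coeff-F j d≤j = begin
      coeff j F
        ≡⟨ coeff-+ₚ j (linearOfPower ℓ D) [ - 1ℤ ] ⟩
      coeff j (linearOfPower ℓ D) + coeff j [ - 1ℤ ]
        ≡⟨ cong₂ _+_ (sym (hasse-at-0 (linearOfPower ℓ D) j)) (coeff-const (- 1ℤ) (ℕₚ.<-≤-trans 0<d d≤j)) ⟩
      hasse (linearOfPower ℓ D) 0ℤ j + 0ℤ
        ≡⟨ +-identityʳ _ ⟩
      hasse (linearOfPower ℓ D) 0ℤ j
        ≡⟨ hasse-linearOfPower ℓ-linear D 0ℤ j ⟩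
      ℓ (hassePower 0ℤ D j)
        ≈⟨ ℓ-hassePower 0ℤ j (D ∸ j) D∸j≤e (All.tabulate (λ {b} _ → ≡⇒≋ (eval-hassePower 0ℤ D j b))) ⟩
      + (D C j) * coeff e (hassePower 0ℤ (D ∸ j) 0) ∎
      where
      open ≋-Reasoning
      D∸j≤e : D ∸ j ≤ e
      D∸j≤e = subst (D ∸ j ≤_) (ℕₚ.m+n∸m≡n d e) (ℕₚ.∸-monoʳ-≤ D d≤j)

    F-leading : coeff d F ≋ + (D C d)
    F-leading = ≋-trans (coeff-F d ℕₚ.≤-refl) (≡⇒≋ (begin
      + (D C d) * coeff e (hassePower 0ℤ (D ∸ d) 0)  ≡⟨ cong (λ n → + (D C d) * coeff e (hassePower 0ℤ n 0))
                                                             (ℕₚ.m+n∸m≡n d e) ⟩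
      + (D C d) * coeff e (hassePower 0ℤ e 0)        ≡⟨ cong (+ (D C d) *_) (coeff-hassePower-top 0ℤ e) ⟩
      + (D C d) * 1ℤ                                 ≡⟨ *-identityʳ (+ (D C d)) ⟩
      + (D C d)                                      ∎))
      where open ≡-Reasoning

    F-degree : DegreeBelow (suc d) F
    F-degree j d<j = ≋-trans (coeff-F j (ℕₚ.<⇒≤ d<j)) (≡⇒≋ vanishing)
      where
      vanishing : + (D C j) * coeff e (hassePower 0ℤ (D ∸ j) 0) ≡ 0ℤ
      vanishing with j ℕₚ.≤? D
      ... | yes j≤D = trans (cong (+ (D C j) *_) (coeff-hassePower-high 0ℤ (D ∸ j)
                              (subst (D ∸ j <_) (ℕₚ.m+n∸m≡n d e) (ℕₚ.∸-monoʳ-< d<j j≤D))))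
                            (*-zeroʳ (+ (D C j)))
      ... | no  j≰D = trans (cong (λ n → + n * coeff e (hassePower 0ℤ (D ∸ j) 0))
                                  (k>n⇒nCk≡0 (ℕₚ.≰⇒> j≰D)))
                            (*-zeroˡ (coeff e (hassePower 0ℤ (D ∸ j) 0)))

    hanson-petridis : ∀ as → Unique as →
                      (∀ {a} → a ∈ as → All (λ b → RootOrZero d (toℤ a + b)) nodes) →
                      sum (map order as) ≤ d
    hanson-petridis as uniq good =
      multiplicities-bound d F F-degree lead≉0 order as uniq (λ {a} a∈as → F-vanishes a (good a∈as))
      where
      lead≉0 : ¬ coeff d F ≋ 0ℤ
      lead≉0 lead≋0 = p∤C d+e<p (ℕₚ.m≤m+n d e) (+≋0⇒∣ (≋-trans (≋-sym F-leading) lead≋0))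

  -- Sumsets

  infixl 6 _⊕_
  _⊕_ : Fin p → Fin p → Fin p
  a ⊕ b = residue (toℕ a ℕ.+ toℕ b)

  toℤ-⊕ : ∀ a b → toℤ (a ⊕ b) ≋ toℤ a + toℤ b
  toℤ-⊕ a b = ≋-trans (toℤ-residue _) (≡⇒≋ (pos-+ (toℕ a) (toℕ b)))

  ⊕-cancelˡ : ∀ a {b b′} → a ⊕ b ≡ a ⊕ b′ → b ≡ b′
  ⊕-cancelˡ a {b} {b′} a⊕b≡a⊕b′ = toℤ-injective (begin
    toℤ b                  ≡⟨ lemma (toℤ a) (toℤ b) ⟩
    toℤ a + toℤ b - toℤ a  ≈⟨ -‿≋ (toℤ-⊕ a b) (≋-refl {toℤ a}) ⟨
    toℤ (a ⊕ b) - toℤ a    ≡⟨ cong (λ c → toℤ c - toℤ a) a⊕b≡a⊕b′ ⟩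
    toℤ (a ⊕ b′) - toℤ a   ≈⟨ -‿≋ (toℤ-⊕ a b′) (≋-refl {toℤ a}) ⟩
    toℤ a + toℤ b′ - toℤ a ≡⟨ lemma (toℤ a) (toℤ b′) ⟨
    toℤ b′                 ∎)
    where
    open ≋-Reasoning
    lemma : ∀ a b → b ≡ a + b - a
    lemma = solve-∀

  𝟎 : Fin p
  𝟎 = residue 0

  toℕ≡0⇒≡𝟎 : ∀ {y} → toℕ y ≡ 0 → y ≡ 𝟎
  toℕ≡0⇒≡𝟎 {y} y≡0 = toℤ-injective (≋-trans (≡⇒≋ (cong +_ y≡0)) (≋-sym (toℤ-residue 0)))

  ≋0⇒toℕ≡0 : ∀ {y} → toℤ y ≋ 0ℤ → toℕ y ≡ 0
  ≋0⇒toℕ≡0 {y} y≋0 = +≋+⇒≡ (toℕ<n y) 0<p y≋0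

  +%≋ : ∀ m → + (m % p) ≋ + m
  +%≋ m = ≋-trans (≡⇒≋ (cong +_ (sym (toℕ-fromℕ< (m%n<n m p))))) (toℤ-residue m)

  ∈μ⇒root : ∀ d (x : Fin p) → x ∈μ d → IsRootOfUnity d x
  ∈μ⇒root d x xᵈ%p≡1%p = begin
    toℤ x ^ d           ≡⟨ pos-^ (toℕ x) d ⟨
    + (toℕ x ℕ.^ d)     ≈⟨ +%≋ (toℕ x ℕ.^ d) ⟨
    + (toℕ x ℕ.^ d % p) ≡⟨ cong +_ xᵈ%p≡1%p ⟩
    + (1 % p)           ≈⟨ +%≋ 1 ⟩
    1ℤ                  ∎
    where open ≋-Reasoning

  root⇒∈μ : ∀ d (x : Fin p) → IsRootOfUnity d x → x ∈μ d
  root⇒∈μ d x xᵈ≋1 = +≋+⇒≡ (m%n<n _ p) (m%n<n 1 p) (begin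
    + (toℕ x ℕ.^ d % p) ≈⟨ +%≋ (toℕ x ℕ.^ d) ⟩
    + (toℕ x ℕ.^ d)     ≡⟨ pos-^ (toℕ x) d ⟩
    toℤ x ^ d           ≈⟨ xᵈ≋1 ⟩
    1ℤ                  ≈⟨ +%≋ 1 ⟨
    + (1 % p)           ∎)
    where open ≋-Reasoning

  ∈elems⁺ : ∀ {A : Subset p} {a} → a ∈ₛ A → a ∈ elems A
  ∈elems⁺ {A} {a} = ∈-filter⁺ (_∈ₛ? A) (∈-allFin a)

  ∈elems⁻ : ∀ {A : Subset p} {a} → a ∈ elems A → a ∈ₛ A
  ∈elems⁻ {A} a∈ = proj₂ (∈-filter⁻ (_∈ₛ? A) {xs = allFin p} a∈)

  ⊕∈Sumset : ∀ {A B : Subset p} {a b} → a ∈ elems A → b ∈ elems B → (a ⊕ b) ∈Sumset A , B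
  ⊕∈Sumset {a = a} {b} a∈A b∈B = a , b , ∈elems⁻ a∈A , ∈elems⁻ b∈B , toℕ-fromℕ< _

  ∈Sumset⇒⊕ : ∀ {A B : Subset p} {x} → x ∈Sumset A , B →
              ∃ λ a → ∃ λ b → a ∈ elems A × b ∈ elems B × x ≡ a ⊕ b
  ∈Sumset⇒⊕ (a , b , a∈A , b∈B , x≡) =
    a , b , ∈elems⁺ a∈A , ∈elems⁺ b∈B , toℕ-injective (trans x≡ (sym (toℕ-fromℕ< _)))

  +sum-map-cong : ∀ {A : Set} (f g : A → ℕ) xs → (∀ x → + f x ≋ + g x) →
                  + sum (map f xs) ≋ + sum (map g xs)
  +sum-map-cong f g xs f≋g =
    ≋-trans (+sum-map-≋ f g 1ℤ xs (λ x → ≋-trans (f≋g x) (≡⇒≋ (sym (*-identityˡ (+ g x))))))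
            (≡⇒≋ (*-identityˡ _))

  elems-unique : ∀ (S : Subset p) → Unique (elems S)
  elems-unique S = Uniqueₚ.filter⁺ (_∈ₛ? S) (Uniqueₚ.allFin⁺ p)

  module Sumset (d i : ℕ) (0<d : 0 < d) (p-1≡ : p ∸ 1 ≡ suc (suc i) ℕ.* d) (A B : Subset p)
                (sums⊆ : ∀ (x : Fin p) → x ∈Sumset A , B → x ∈μ d ⊎ toℕ x ≡ 0)
                (μ⊆sums : ∀ (x : Fin p) → x ∈μ d → x ∈Sumset A , B) where

    As : List (Fin p)
    As = elems A

    Bs : List (Fin p)
    Bs = elems B

    sums : List (Fin p)
    sums = cartesianProductWith _⊕_ As Bs

    nonzero? : ∀ (y : Fin p) → Dec (toℕ y ≢ 0)
    nonzero? y = ¬? (toℕ y ℕₚ.≟ 0)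

    nonzeroSums : List (Fin p)
    nonzeroSums = filter nonzero? sums

    root-or-zero : ∀ {a b} → a ∈ As → b ∈ Bs → RootOrZero d (toℤ a + toℤ b)
    root-or-zero {a} {b} a∈A b∈B with sums⊆ (a ⊕ b) (⊕∈Sumset a∈A b∈B)
    ... | inj₁ a⊕b∈μ = inj₁ (≋-trans (^-≋ d (≋-sym (toℤ-⊕ a b))) (∈μ⇒root d (a ⊕ b) a⊕b∈μ))
    ... | inj₂ a⊕b≡0 = inj₂ (≋-trans (≋-sym (toℤ-⊕ a b)) (≡⇒≋ (cong +_ a⊕b≡0)))

    root-nonzero : ∀ y → IsRootOfUnity d y → toℕ y ≢ 0
    root-nonzero y yᵈ≋1 y≡0 = 1≉0 (begin
      1ℤ         ≈⟨ yᵈ≋1 ⟨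
      toℤ y ^ d  ≡⟨ cong (λ n → (+ n) ^ d) y≡0 ⟩
      0ℤ ^ d     ≡⟨ 0^-≡0 0<d ⟩
      0ℤ         ∎)
      where open ≋-Reasoning

    μ⊆nonzeroSums : μ d ⊆ nonzeroSums
    μ⊆nonzeroSums {y} y∈μ = as-sum (∈Sumset⇒⊕ {A} {B} {y} (μ⊆sums y (root⇒∈μ d y yᵈ≋1)))
      where
      yᵈ≋1 = ∈μ⁻ d y∈μ
      as-sum : (∃ λ a → ∃ λ b → a ∈ As × b ∈ Bs × y ≡ a ⊕ b) → y ∈ nonzeroSums
      as-sum (a , b , a∈A , b∈B , y≡a⊕b) = subst (_∈ nonzeroSums) (sym y≡a⊕b)
        (∈-filter⁺ nonzero? (∈-cartesianProductWith⁺ _⊕_ a∈A b∈B)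
                   (root-nonzero (a ⊕ b) (subst (IsRootOfUnity d) y≡a⊕b yᵈ≋1)))

    1∈sums : ∃ λ a → ∃ λ b → a ∈ As × b ∈ Bs × residue 1 ≡ a ⊕ b
    1∈sums = ∈Sumset⇒⊕ {A} {B} {residue 1} (μ⊆sums (residue 1) (root⇒∈μ d (residue 1) 1ᵈ≋1))
      where
      1ᵈ≋1 : toℤ (residue 1) ^ d ≋ 1ℤ
      1ᵈ≋1 = ≋-trans (^-≋ d (toℤ-residue 1)) (≡⇒≋ (^-zeroˡ d))

    -- b ↦ a₀ + b injects B into μ_d ∪ {0}, for any a₀ ∈ A
    B-small : length Bs ≤ suc d
    B-small = begin
      length Bs                 ≡⟨ length-map (a₀ ⊕_) Bs ⟨
      length (map (a₀ ⊕_) Bs)   ≤⟨ Unique-⊆⇒length≤ (map (a₀ ⊕_) Bs) (𝟎 ∷ μ d) shifted-unique shifted⊆ ⟩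
      suc (length (μ d))        ≤⟨ s≤s (μ-upper d 0<d) ⟩
      suc d                     ∎
      where
      open ℕₚ.≤-Reasoning
      a₀ : Fin p
      a₀ = proj₁ 1∈sums
      a₀∈A : a₀ ∈ As
      a₀∈A = proj₁ (proj₂ (proj₂ 1∈sums))
      shifted-unique : Unique (map (a₀ ⊕_) Bs)
      shifted-unique = Uniqueₚ.map⁺ {f = a₀ ⊕_} (⊕-cancelˡ a₀) (elems-unique B)
      shifted⊆ : map (a₀ ⊕_) Bs ⊆ 𝟎 ∷ μ d
      shifted⊆ {y} y∈ = from-row (∈-map⁻ (a₀ ⊕_) y∈)
        where
        classify : ∀ b → RootOrZero d (toℤ a₀ + toℤ b) → a₀ ⊕ b ∈ 𝟎 ∷ μ d
        classify b (inj₁ root)  = there (∈μ⁺ d {a₀ ⊕ b} (≋-trans (^-≋ d (toℤ-⊕ a₀ b)) root))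
        classify b (inj₂ sum≋0) = here (toℕ≡0⇒≡𝟎 {a₀ ⊕ b} (≋0⇒toℕ≡0 {a₀ ⊕ b} (≋-trans (toℤ-⊕ a₀ b) sum≋0)))
        from-row : (∃ λ b → b ∈ Bs × y ≡ a₀ ⊕ b) → y ∈ 𝟎 ∷ μ d
        from-row (b , b∈B , y≡a₀⊕b) =
          subst (_∈ 𝟎 ∷ μ d) (sym y≡a₀⊕b) (classify b (root-or-zero a₀∈A b∈B))

    2d<p : d ℕ.+ d < p
    2d<p = begin-strict
      d ℕ.+ d                 ≤⟨ ℕₚ.+-monoʳ-≤ d (ℕₚ.m≤m+n d (i ℕ.* d)) ⟩
      suc (suc i) ℕ.* d       ≡⟨ p-1≡ ⟨
      p ∸ 1                   <⟨ ℕₚ.n<1+n (p ∸ 1) ⟩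
      suc (p ∸ 1)             ≡⟨ ℕₚ.m+[n∸m]≡n (ℕₚ.<⇒≤ 1<p) ⟩
      p                       ∎
      where open ℕₚ.≤-Reasoning

    d≤|μ| : d ≤ length (μ d)
    d≤|μ| = μ-lower d (suc i) p-1≡

    module _ (b₀ : Fin p) (bs : List (Fin p)) (Bs≡ : Bs ≡ b₀ ∷ bs) where

      private
        |bs|≤d : length bs ≤ d
        |bs|≤d = ℕₚ.≤-pred (subst (λ xs → length xs ≤ suc d) Bs≡ B-small)

      open HansonPetridis d 0<d b₀ bs (subst Unique Bs≡ (elems-unique B)) (ℕₚ.≤-<-trans (ℕₚ.+-monoʳ-≤ d |bs|≤d) 2d<p)

      nonzero-row : ∀ a → length (filter nonzero? (map (a ⊕_) Bs)) ≤ order a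
      nonzero-row a = bound (avoids? (toℤ a))
        where
        row = map (a ⊕_) Bs
        length-row : length row ≡ suc e
        length-row = trans (length-map (a ⊕_) Bs) (cong length Bs≡)
        bound : (avoids : Dec (Avoids (toℤ a))) → length (filter nonzero? row) ≤ (if does avoids then suc e else e)
        bound (yes _)      = subst (length (filter nonzero? row) ≤_) length-row (length-filter nonzero? row)
        bound (no ¬avoids) =
          ℕₚ.≤-pred (subst (length (filter nonzero? row) <_) length-row (filter-notAll nonzero? row zero∈row))
          where
          zero-node : Any (λ b → ¬ ¬ toℤ a + b ≋ 0ℤ) nodes
          zero-node = ¬All⇒Any¬ (λ b → ¬? (≋0? (toℤ a + b))) nodes ¬avoids
          zero-sum : ∀ {b} → ¬ ¬ toℤ a + toℤ b ≋ 0ℤ → ¬ toℕ (a ⊕ b) ≢ 0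
          zero-sum {b} ¬¬a+b≋0 a⊕b≢0 = ¬¬a+b≋0 (a⊕b≢0 ∘ ≋0⇒toℕ≡0 ∘ ≋-trans (toℤ-⊕ a b))
          zero∈row : Any (λ y → ¬ toℕ y ≢ 0) row
          zero∈row = Anyₚ.map⁺ (subst (Any (λ b → ¬ toℕ (a ⊕ b) ≢ 0)) (sym Bs≡)
                                      (Any.map zero-sum (Anyₚ.map⁻ zero-node)))

      nonzero-rows : ∀ as → length (filter nonzero? (cartesianProductWith _⊕_ as Bs)) ≤ sum (map order as)
      nonzero-rows []       = z≤n
      nonzero-rows (a ∷ as) = begin
        length (filter nonzero? (row ++ rest))                       ≡⟨ cong length (filter-++ nonzero? row rest) ⟩
        length (filter nonzero? row ++ filter nonzero? rest)         ≡⟨ length-++ (filter nonzero? row) ⟩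
        length (filter nonzero? row) ℕ.+ length (filter nonzero? rest) ≤⟨ ℕₚ.+-mono-≤ (nonzero-row a) (nonzero-rows as) ⟩
        order a ℕ.+ sum (map order as)                               ∎
        where
        open ℕₚ.≤-Reasoning
        row = map (a ⊕_) Bs
        rest = cartesianProductWith _⊕_ as Bs

      nonzeroSums-↭-μ′ : nonzeroSums ↭ μ d
      nonzeroSums-↭-μ′ = ⊇-length≤⇒↭ nonzeroSums (μ d) (μ-unique d) μ⊆nonzeroSums (begin
        length nonzeroSums    ≤⟨ nonzero-rows As ⟩
        sum (map order As)    ≤⟨ hanson-petridis As (elems-unique A) good ⟩
        d                     ≤⟨ d≤|μ| ⟩
        length (μ d)          ∎)
        where
        open ℕₚ.≤-Reasoning
        good : ∀ {a} → a ∈ As → All (λ b → RootOrZero d (toℤ a + b)) nodes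
        good a∈A = Allₚ.map⁺ (All.tabulate (λ b∈ → root-or-zero a∈A (subst (_ ∈_) (sym Bs≡) b∈)))

    nonzeroSums-↭-μ : nonzeroSums ↭ μ d
    nonzeroSums-↭-μ = uncons Bs refl (proj₁ (proj₂ (proj₂ (proj₂ 1∈sums))))
      where
      uncons : ∀ {b} xs → Bs ≡ xs → b ∈ xs → nonzeroSums ↭ μ d
      uncons (b₀ ∷ bs) Bs≡ _ = nonzeroSums-↭-μ′ b₀ bs Bs≡

    sumPow≋ : ∀ k as → + sum (concatMap (λ a → concatMap (λ b → (toℕ a ℕ.+ toℕ b) ℕ.^ k ∷ []) Bs) as)
                     ≋ + sum (map (λ y → toℕ y ℕ.^ k) (cartesianProductWith _⊕_ as Bs))
    sumPow≋ k []       = ≋-refl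
    sumPow≋ k (a ∷ as) = begin
      + sum (row ++ rest)                           ≡⟨ cong +_ (sum-++ row rest) ⟩
      + (sum row ℕ.+ sum rest)                      ≡⟨ pos-+ (sum row) (sum rest) ⟩
      + sum row + + sum rest                        ≈⟨ +-≋ row≋ (sumPow≋ k as) ⟩
      + sum (map g row′) + + sum (map g rest′)      ≡⟨ pos-+ (sum (map g row′)) (sum (map g rest′)) ⟨
      + (sum (map g row′) ℕ.+ sum (map g rest′))    ≡⟨ cong +_ (sum-++ (map g row′) (map g rest′)) ⟨
      + sum (map g row′ ++ map g rest′)             ≡⟨ cong (λ ys → + sum ys) (map-++ g row′ rest′) ⟨
      + sum (map g (row′ ++ rest′))                 ∎
      where
      open ≋-Reasoning
      g : Fin p → ℕ
      g y = toℕ y ℕ.^ k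
      h : Fin p → ℕ
      h b = (toℕ a ℕ.+ toℕ b) ℕ.^ k
      row = concatMap (λ b → h b ∷ []) Bs
      rest = concatMap (λ a → concatMap (λ b → (toℕ a ℕ.+ toℕ b) ℕ.^ k ∷ []) Bs) as
      row′ = map (a ⊕_) Bs
      rest′ = cartesianProductWith _⊕_ as Bs
      row≋ : + sum row ≋ + sum (map g row′)
      row≋ = begin
        + sum row                   ≡⟨ cong (λ ys → + sum ys) (trans (sym (concatMap-map [_] h Bs))
                                                                     (concatMap-pure (map h Bs))) ⟩
        + sum (map h Bs)            ≈⟨ +sum-map-cong h (g ∘ (a ⊕_)) Bs term ⟩
        + sum (map (g ∘ (a ⊕_)) Bs) ≡⟨ cong (λ ys → + sum ys) (map-∘ Bs) ⟩
        + sum (map g row′)          ∎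
        where
        term : ∀ b → + h b ≋ + g (a ⊕ b)
        term b = begin
          + h b                          ≡⟨ pos-^ (toℕ a ℕ.+ toℕ b) k ⟩
          (+ (toℕ a ℕ.+ toℕ b)) ^ k      ≡⟨ cong (_^ k) (pos-+ (toℕ a) (toℕ b)) ⟩
          (toℤ a + toℤ b) ^ k            ≈⟨ ^-≋ k (toℤ-⊕ a b) ⟨
          toℤ (a ⊕ b) ^ k                ≡⟨ pos-^ (toℕ (a ⊕ b)) k ⟨
          + g (a ⊕ b)                    ∎

    sumPow≋0 : ∀ k → 0 < k → k < d → + sumPow A B k ≋ 0ℤ
    sumPow≋0 k 0<k k<d = begin
      + sumPow A B k             ≈⟨ sumPow≋ k As ⟩
      + sum (map g sums)         ≡⟨ cong +_ (sum-map-filter nonzero? g g-zero sums) ⟩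
      + sum (map g nonzeroSums)  ≡⟨ cong +_ (sum-↭ (↭-map⁺ g nonzeroSums-↭-μ)) ⟩
      + sum (map g (μ d))        ≈⟨ μ-powerSum d k 0<k k<d d≤|μ| ⟩
      0ℤ                         ∎
      where
      open ≋-Reasoning
      g : Fin p → ℕ
      g y = toℕ y ℕ.^ k
      g-zero : ∀ y → ¬ toℕ y ≢ 0 → g y ≡ 0
      g-zero y y≡0 = trans (cong (ℕ._^ k) (Dec.decidable-stable (toℕ y ℕₚ.≟ 0) y≡0)) (0^ k 0<k)
        where 0^ : ∀ k → 0 < k → 0 ℕ.^ k ≡ 0
              0^ (suc k) _ = refl

proper-divisor-cofactor : ∀ {d n} → d ∣ n → d < n → ∃ λ i → n ≡ suc (suc i) ℕ.* d
proper-divisor-cofactor     (divides zero          n≡0) d<n = ⊥-elim (ℕₚ.<⇒≢ (ℕₚ.≤-<-trans z≤n d<n) (sym n≡0))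
proper-divisor-cofactor {d} (divides (suc zero)    n≡d) d<n = ⊥-elim (ℕₚ.<⇒≢ d<n (sym (trans n≡d (ℕₚ.+-identityʳ d))))
proper-divisor-cofactor     (divides (suc (suc i)) n≡ ) _   = i , n≡

lemma3 : (p : ℕ) → .{{_ : NonZero p}} → Prime p → (d : ℕ) → d ∣ p ∸ 1 → 1 < d → d < p ∸ 1 →
    (A B : Subset p) →
    ((∀ (x : Fin p) → (x ∈Sumset A , B) ⇔ (x ∈μ d))
      ⊎ (∀ (x : Fin p) → (x ∈Sumset A , B) ⇔ ((x ∈μ d) ⊎ (toℕ x ≡ 0)))) →
    (k : ℕ) → 1 ≤ k → k < d → sumPow A B k % p ≡ 0
lemma3 p p-prime d d∣p-1 1<d d<p-1 A B A+B≈ k 0<k k<d with proper-divisor-cofactor d∣p-1 d<p-1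
... | i , p-1≡ = n∣m⇒m%n≡0 (sumPow A B k) p (+≋0⇒∣ p p-prime sumPow≋0)
  where
  sums⊆ : ∀ (x : Fin p) → x ∈Sumset A , B → x ∈μ d ⊎ toℕ x ≡ 0
  sums⊆ x = [ (λ A+B≈μ → inj₁ ∘ Equivalence.to (A+B≈μ x))
            , (λ A+B≈μ₀ → Equivalence.to (A+B≈μ₀ x)) ]′ A+B≈
  μ⊆sums : ∀ (x : Fin p) → x ∈μ d → x ∈Sumset A , B
  μ⊆sums x = [ (λ A+B≈μ → Equivalence.from (A+B≈μ x))
             , (λ A+B≈μ₀ → Equivalence.from (A+B≈μ₀ x) ∘ inj₁) ]′ A+B≈
  sumPow≋0 : _≋_ p p-prime (+ sumPow A B k) 0ℤ
  sumPow≋0 = Sumset.sumPow≋0 p p-prime d i (ℕₚ.<-trans (s≤s z≤n) 1<d) p-1≡ A B sums⊆ μ⊆sums k 0<k k<d
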